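{- Let $f\in\mathbb{Q}\langle C\rangle$ be homogeneous of degree $n$ and depth $r$, and $g\in\mathbb{Q}\langle C\rangle$ homogeneous of degree $m$ and depth $s$. Then $ma_{\{f,g\}}=ari(ma_f,ma_g)$, where $\{f,g\}=[f,g]+D_f(g)-D_g(f)$ is the Poisson bracket.
   Context: $C_i=\mathrm{ad}(x)^{i-1}(y)$; $\mathbb{Q}\langle C\rangle$ is the subring of $\mathbb{Q}\langle x,y\rangle$ freely generated by the $C_i$. Depth = number of letters $y$. For $h$ homogeneous of degree $n$ and depth $r$, $h=\sum c_{\mathbf a}C_{a_1}\cdots C_{a_r}$, $ma_h$ is the mould concentrated in depth $r$ with $ma_h(u_1,\dots,u_r)=(-1)^{r+n}\sum c_{\mathbf a}u_1^{a_1-1}\cdots u_r^{a_r-1}$, extended linearly. For $h\in\mathbb{Q}\langle x,y\rangle$, $D_h$ is the derivation of $\mathbb{Q}\langle x,y\rangle$ with $D_h(x)=0$, $D_h(y)=[y,h]$. Moulds: $mu(A,B)(u_1..u_r)=\sum_{i=0}^rA(u_1..u_i)B(u_{i+1}..u_r)$, $limu(A,B)=mu(A,B)-mu(B,A)$. For $\mathbf w=\mathbf a\mathbf b\mathbf c$ as consecutive blocks $\mathbf a=(u_1..u_k)$, $\mathbf b=(u_{k+1}..u_{k+l})$, $\mathbf c=(u_{k+l+1}..u_r)$: $\mathbf a\lceil\mathbf c=(u_1,\dots,u_k,u_{k+1}+\dots+u_{k+l+1},u_{k+l+2},\dots,u_r)$ (for $\mathbf b,\mathbf c\ne\emptyset$),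 $\mathbf a\rceil\mathbf c=(u_1,\dots,u_{k-1},u_k+\dots+u_{k+l},u_{k+l+1},\dots,u_r)$ (for $\mathbf a,\mathbf b\ne\emptyset$). $(arit(B)A)(\mathbf w)=\sum_{\mathbf b,\mathbf c\ne\emptyset}A(\mathbf a\lceil\mathbf c)B(\mathbf b)-\sum_{\mathbf a,\mathbf b\ne\emptyset}A(\mathbf a\rceil\mathbf c)B(\mathbf b)$; $ari(A,B)=arit(B)A-arit(A)B+limu(A,B)$. -}

module Defs where

open import Data.Nat as ℕ using (ℕ; zero; suc)
import Data.Nat.ListAction as ListAction
open import Data.Rational using (ℚ; 0ℚ; 1ℚ; _+_; _*_; -_)
open import Data.List using (List; []; _∷_; _++_; map; length; concatMap; foldr)
open import Data.Product using (_×_; _,_)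
open import Data.Bool using (if_then_else_)
open import Relation.Nullary using (¬_)
open import Relation.Nullary.Decidable using (⌊_⌋)
open import Relation.Binary.PropositionalEquality using (_≡_)

data Letter : Set where
  X Y : Letter

_≟L_ : (a b : Letter) → Data.Bool.Bool
X ≟L X = Data.Bool.true
Y ≟L Y = Data.Bool.true
_ ≟L _ = Data.Bool.false

Word : Set
Word = List Letter

_≟W_ : Word → Word → Data.Bool.Bool
[] ≟W [] = Data.Bool.true
(a ∷ v) ≟W (b ∷ w) = (a ≟L b) Data.Bool.∧ (v ≟W w)
_ ≟W _ = Data.Bool.false

-- A (non-commutative) polynomial is a formal finite ℚ-linear
-- combination of words; two such are equal iff all coefficients agree.
Poly : Set
Poly = List (ℚ × Word)

Σℚ : List ℚ → ℚ
Σℚ = foldr _+_ 0ℚ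

Πℚ : List ℚ → ℚ
Πℚ = foldr _*_ 1ℚ

coeff : Poly → Word → ℚ
coeff p w = Σℚ (map (λ { (c , v) → if v ≟W w then c else 0ℚ }) p)

_≈P_ : Poly → Poly → Set
p ≈P q = ∀ w → coeff p w ≡ coeff q w

depthW : Word → ℕ
depthW [] = 0
depthW (X ∷ w) = depthW w
depthW (Y ∷ w) = suc (depthW w)

Homogeneous : ℕ → ℕ → Poly → Set
Homogeneous n r p = ∀ w → ¬ (coeff p w ≡ 0ℚ) → (length w ≡ n) × (depthW w ≡ r)

x̂ ŷ : Poly
x̂ = (1ℚ , X ∷ []) ∷ []
ŷ = (1ℚ , Y ∷ []) ∷ []

oneP : Poly
oneP = (1ℚ , []) ∷ []

_+P_ : Poly → Poly → Poly
p +P q = p ++ q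

scaleP : ℚ → Poly → Poly
scaleP a = map (λ { (c , w) → (a * c , w) })

-P_ : Poly → Poly
-P p = scaleP (- 1ℚ) p

_-P_ : Poly → Poly → Poly
p -P q = p +P (-P q)

_*P_ : Poly → Poly → Poly
p *P q = concatMap (λ { (c , v) → map (λ { (d , w) → (c * d , v ++ w) }) q }) p

[_,_]P : Poly → Poly → Poly
[ p , q ]P = (p *P q) -P (q *P p)

-- C_i = ad(x)^{i-1}(y).  Convention: Cidx k denotes C_{k+1}, i.e. the
-- index k ∈ ℕ stands for C_{k+1} (so C_1 = y is Cidx 0).
Cidx : ℕ → Poly
Cidx zero = ŷ
Cidx (suc k) = [ x̂ , Cidx k ]P

-- Elements of ℚ⟨C⟩, given by their expansion Σ c_a C_{a_1} ⋯ C_{a_r}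
-- (a term (c , k₁ ∷ … ∷ k_r) stands for c · C_{k₁+1} ⋯ C_{k_r+1}).

CPoly : Set
CPoly = List (ℚ × List ℕ)

prodP : List Poly → Poly
prodP = foldr _*P_ oneP

evalC : CPoly → Poly
evalC h = concatMap (λ { (c , ks) → scaleP c (prodP (map Cidx ks)) }) h

-- Moulds (with values in ℚ, as functions of the variables u₁,…,u_r;
-- the depth of an argument is its length).

Mould : Set
Mould = List ℚ → ℚ

_≈M_ : Mould → Mould → Set
A ≈M B = ∀ u → A u ≡ B u

powℚ : ℚ → ℕ → ℚ
powℚ q zero = 1ℚ
powℚ q (suc k) = q * powℚ q k

signℚ : ℕ → ℚ
signℚ zero = 1ℚ
signℚ (suc zero) = - 1ℚ
signℚ (suc (suc k)) = signℚ k

monM : List ℕ → Mould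
monM [] [] = 1ℚ
monM (k ∷ ks) (u ∷ us) = powℚ u k * monM ks us
monM _ _ = 0ℚ

-- ma of a single term c · C_{a₁}⋯C_{a_r} (a_i = k_i + 1), which is
-- homogeneous of degree n = Σ a_i and depth r; then extended linearly.
maTerm : ℚ × List ℕ → Mould
maTerm (c , ks) u =
  signℚ (length ks ℕ.+ ListAction.sum (map suc ks)) * c * monM ks u

ma : CPoly → Mould
ma h u = Σℚ (map (λ t → maTerm t u) h)

D-letter : Poly → Letter → Poly
D-letter h X = []
D-letter h Y = [ ŷ , h ]P

wordP : Word → Poly
wordP w = (1ℚ , w) ∷ []

D-word : Poly → Word → Poly
D-word h [] = []
D-word h (l ∷ w) = (D-letter h l *P wordP w) +P (wordP (l ∷ []) *P D-word h w)

D : Poly → Poly → Poly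
D h p = concatMap (λ { (c , w) → scaleP c (D-word h w) }) p

poisson : Poly → Poly → Poly
poisson f g = ([ f , g ]P +P D f g) -P D g f

splits : {A : Set} → List A → List (List A × List A)
splits [] = ([] , []) ∷ []
splits (x ∷ xs) = ([] , x ∷ xs) ∷ map (λ { (a , b) → (x ∷ a , b) }) (splits xs)

mu : Mould → Mould → Mould
mu A B w = Σℚ (map (λ { (a , b) → A a * B b }) (splits w))

limu : Mould → Mould → Mould
limu A B w = mu A B w + (- mu B A w)

splits3 : {A : Set} → List A → List (List A × List A × List A)
splits3 w = concatMap (λ { (a , r) → map (λ { (b , c) → (a , b , c) }) (splits r) }) (splits w)

-- a⌈c for b,c nonempty (the first element of c is replaced by Σb + c₁)
-- contribution A(a⌈c)B(b), and 0 if b or c is empty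
leftTerm : Mould → Mould → List ℚ × List ℚ × List ℚ → ℚ
leftTerm A B (a , [] , c) = 0ℚ
leftTerm A B (a , b@(_ ∷ _) , []) = 0ℚ
leftTerm A B (a , b@(_ ∷ _) , c₁ ∷ c) = A (a ++ (Σℚ b + c₁) ∷ c) * B b

-- a⌉c for a,b nonempty: last element a_k of a replaced by a_k + Σb
capR : List ℚ → ℚ → List ℚ → List ℚ
capR [] s c = c
capR (x ∷ []) s c = (x + s) ∷ c
capR (x ∷ y ∷ a) s c = x ∷ capR (y ∷ a) s c

rightTerm : Mould → Mould → List ℚ × List ℚ × List ℚ → ℚ
rightTerm A B ([] , b , c) = 0ℚ
rightTerm A B (a@(_ ∷ _) , [] , c) = 0ℚ
rightTerm A B (a@(_ ∷ _) , b@(_ ∷ _) , c) = A (capR a (Σℚ b) c) * B b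

-- (arit(B) A)(w)
arit : Mould → Mould → Mould
arit B A w = Σℚ (map (leftTerm A B) (splits3 w))
           + (- Σℚ (map (rightTerm A B) (splits3 w)))

ari : Mould → Mould → Mould
ari A B w = arit B A w + (- arit A B w) + limu A B w

module Submission where

-- Both sides are linear in the formal expansions of f and g, so everything is
-- organised around the linear extension  L φ p = Σ c · φ(w)  of a function φ on
-- words (or on index lists) to a formal combination p.
--
-- 1. Two polynomials have the same coefficients iff every L φ agrees on them.
-- 2. There is a functional ψ_u on words with ψ_u(C_{k₁+1}⋯C_{k_r+1}) equal to
--    the signed monomial (-u₁)^{k₁}⋯(-u_r)^{k_r}; hence ma h u = L ψ_u (evalC h),
--    so ma h only depends on the polynomial evalC h.
-- 3. Product, ad(x) and the derivation D_f are lifted to expansions in the C_i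
--    (cmul, adC, cD); this gives an explicit expansion cpoisson f g of {f,g}.
--    For D_f the key facts are D_f(C_1) = [y,f], D_f ∘ ad(x) = ad(x) ∘ D_f and
--    the Leibniz rule.
-- 4. On moulds, cmul becomes mu, adC multiplies by -(u₁+⋯+u_r), and cD f
--    becomes -arit(ma f); the last identity is proved by induction on the
--    monomial.

open import Defs
open import Data.Nat as ℕ using (ℕ; zero; suc; z≤n; s≤s)
import Data.Nat.Properties as ℕP
import Data.Nat.ListAction as ListAction
open import Data.Rational using (ℚ; 0ℚ; 1ℚ; _+_; _*_; -_)
open import Data.Rational.Properties
  using (+-identityʳ; +-identityˡ; *-zeroʳ; *-zeroˡ; +-assoc; *-comm; *-assoc; *-identityˡ; *-identityʳ; *-distribˡ-+; +-inverseʳ; +-0-group)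
open import Data.Rational.Solver
open import Data.List using (List; []; _∷_; _++_; map; length; concatMap)
open import Data.List.Properties using (++-assoc; ++-identityʳ; map-++)
open import Data.Product using (_×_; _,_; proj₁; proj₂; Σ)
open import Data.Bool using (Bool; true; false; if_then_else_; _∧_)
open import Relation.Binary.PropositionalEquality
open import Algebra.Properties.Group +-0-group using (x∙y⁻¹≈ε⇒x≈y)
open +-*-Solver
open ≡-Reasoning

private variable
  I I′ : Set

L : (List I → ℚ) → List (ℚ × List I) → ℚ
L φ [] = 0ℚ
L φ ((c , w) ∷ p) = c * φ w + L φ p

L-++ : (φ : List I → ℚ) (p q : List (ℚ × List I)) → L φ (p ++ q) ≡ L φ p + L φ q
L-++ φ [] q = sym (+-identityˡ _)
L-++ φ ((c , w) ∷ p) q rewrite L-++ φ p q = sym (+-assoc (c * φ w) (L φ p) (L φ q))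

L-cong : {φ ψ : List I → ℚ} (p : List (ℚ × List I)) → (∀ w → φ w ≡ ψ w) → L φ p ≡ L ψ p
L-cong [] e = refl
L-cong ((c , w) ∷ p) e = cong₂ (λ a b → c * a + b) (e w) (L-cong p e)

L-+ : (φ ψ : List I → ℚ) (p : List (ℚ × List I)) → L (λ w → φ w + ψ w) p ≡ L φ p + L ψ p
L-+ φ ψ [] = sym (+-identityʳ 0ℚ)
L-+ φ ψ ((c , w) ∷ p) rewrite L-+ φ ψ p =
  solve 5 (λ c a b x y → c :* (a :+ b) :+ (x :+ y) := c :* a :+ x :+ (c :* b :+ y)) refl c (φ w) (ψ w) (L φ p) (L ψ p)

L-* : (a : ℚ) (φ : List I → ℚ) (p : List (ℚ × List I)) → L (λ w → a * φ w) p ≡ a * L φ p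
L-* a φ [] = sym (*-zeroʳ a)
L-* a φ ((c , w) ∷ p) rewrite L-* a φ p =
  solve 4 (λ a c f x → c :* (a :* f) :+ a :* x := a :* (c :* f :+ x)) refl a c (φ w) (L φ p)

L-*ʳ : (a : ℚ) (φ : List I → ℚ) (p : List (ℚ × List I)) → L (λ w → φ w * a) p ≡ L φ p * a
L-*ʳ a φ p = trans (L-cong p (λ w → *-comm (φ w) a)) (trans (L-* a φ p) (*-comm a (L φ p)))

L-neg : (φ : List I → ℚ) (p : List (ℚ × List I)) → L (λ w → - φ w) p ≡ - L φ p
L-neg φ [] = refl
L-neg φ ((c , w) ∷ p) rewrite L-neg φ p =
  solve 3 (λ c f x → c :* (:- f) :+ (:- x) := :- (c :* f :+ x)) refl c (φ w) (L φ p)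

L-0 : (p : List (ℚ × List I)) → L (λ _ → 0ℚ) p ≡ 0ℚ
L-0 [] = refl
L-0 ((c , w) ∷ p) rewrite L-0 p = solve 1 (λ c → c :* con 0ℚ :+ con 0ℚ := con 0ℚ) refl c

L-swap : (F : List I → List I′ → ℚ) (p : List (ℚ × List I)) (q : List (ℚ × List I′)) →
  L (λ v → L (λ w → F v w) q) p ≡ L (λ w → L (λ v → F v w) p) q
L-swap F [] q = sym (L-0 q)
L-swap F ((c , v) ∷ p) q = begin
    c * L (λ w → F v w) q + L (λ v → L (λ w → F v w) q) p
  ≡⟨ cong₂ _+_ (sym (L-* c (λ w → F v w) q)) (L-swap F p q) ⟩
    L (λ w → c * F v w) q + L (λ w → L (λ v → F v w) p) q
  ≡⟨ sym (L-+ _ _ q) ⟩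
    L (λ w → c * F v w + L (λ v → F v w) p) q ∎

-- Every operation below is built with map or concatMap; these two lemmas
-- compute L on such lists from the effect on a single term.
L-map : (φ : List I → ℚ) (χ : List I′ → ℚ) (g : ℚ × List I′ → ℚ × List I) (p : List (ℚ × List I′)) →
  (∀ c v → proj₁ (g (c , v)) * φ (proj₂ (g (c , v))) ≡ c * χ v) → L φ (map g p) ≡ L χ p
L-map φ χ g [] e = refl
L-map φ χ g ((c , v) ∷ p) e = cong₂ _+_ (e c v) (L-map φ χ g p e)

L-concatMap : (φ : List I → ℚ) (χ : List I′ → ℚ) (g : ℚ × List I′ → List (ℚ × List I)) (p : List (ℚ × List I′)) →
  (∀ c v → L φ (g (c , v)) ≡ c * χ v) → L φ (concatMap g p) ≡ L χ p
L-concatMap φ χ g [] e = refl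
L-concatMap φ χ g ((c , v) ∷ p) e =
  trans (L-++ φ (g (c , v)) (concatMap g p)) (cong₂ _+_ (e c v) (L-concatMap φ χ g p e))

scale-term : (a c : ℚ) (φ : List I → ℚ) (w : List I) → a * c * φ w ≡ c * (a * φ w)
scale-term a c φ w = solve 3 (λ a c f → a :* c :* f := c :* (a :* f)) refl a c (φ w)

row-term : (c d : ℚ) (φ : List I → ℚ) (v w : List I) → c * d * φ (v ++ w) ≡ d * (c * φ (v ++ w))
row-term c d φ v = scale-term c d (λ w → φ (v ++ w))

Σ-++ : (xs ys : List ℚ) → Σℚ (xs ++ ys) ≡ Σℚ xs + Σℚ ys
Σ-++ [] ys = sym (+-identityˡ _)
Σ-++ (x ∷ xs) ys rewrite Σ-++ xs ys = sym (+-assoc x _ _)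

Σ-cong : {f g : I → ℚ} (l : List I) → (∀ b → f b ≡ g b) → Σℚ (map f l) ≡ Σℚ (map g l)
Σ-cong [] e = refl
Σ-cong (b ∷ l) e = cong₂ _+_ (e b) (Σ-cong l e)

Σ-+ : (f g : I → ℚ) (l : List I) → Σℚ (map (λ b → f b + g b) l) ≡ Σℚ (map f l) + Σℚ (map g l)
Σ-+ f g [] = sym (+-identityʳ 0ℚ)
Σ-+ f g (b ∷ l) rewrite Σ-+ f g l =
  solve 4 (λ a b x y → (a :+ b) :+ (x :+ y) := a :+ x :+ (b :+ y)) refl (f b) (g b) (Σℚ (map f l)) (Σℚ (map g l))

Σ-* : (a : ℚ) (f : I → ℚ) (l : List I) → Σℚ (map (λ b → a * f b) l) ≡ a * Σℚ (map f l)
Σ-* a f [] = sym (*-zeroʳ a)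
Σ-* a f (b ∷ l) rewrite Σ-* a f l =
  solve 3 (λ a x y → a :* x :+ a :* y := a :* (x :+ y)) refl a (f b) (Σℚ (map f l))

Σ-neg : (f : I → ℚ) (l : List I) → Σℚ (map (λ b → - f b) l) ≡ - Σℚ (map f l)
Σ-neg f [] = refl
Σ-neg f (b ∷ l) rewrite Σ-neg f l =
  solve 2 (λ x y → (:- x) :+ (:- y) := :- (x :+ y)) refl (f b) (Σℚ (map f l))

Σ-0 : {f : I → ℚ} (l : List I) → (∀ b → f b ≡ 0ℚ) → Σℚ (map f l) ≡ 0ℚ
Σ-0 [] e = refl
Σ-0 (b ∷ l) e rewrite e b | Σ-0 l e = +-identityʳ 0ℚ

Σ-map : (f : I′ → ℚ) (g : I → I′) (l : List I) → Σℚ (map f (map g l)) ≡ Σℚ (map (λ b → f (g b)) l)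
Σ-map f g [] = refl
Σ-map f g (b ∷ l) = cong (f (g b) +_) (Σ-map f g l)

Σ-concatMap : (f : I′ → ℚ) (g : I → List I′) (l : List I) →
  Σℚ (map f (concatMap g l)) ≡ Σℚ (map (λ b → Σℚ (map f (g b))) l)
Σ-concatMap f g [] = refl
Σ-concatMap f g (b ∷ l) = begin
    Σℚ (map f (g b ++ concatMap g l))
  ≡⟨ cong Σℚ (map-++ f (g b) (concatMap g l)) ⟩
    Σℚ (map f (g b) ++ map f (concatMap g l))
  ≡⟨ Σ-++ (map f (g b)) _ ⟩
    Σℚ (map f (g b)) + Σℚ (map f (concatMap g l))
  ≡⟨ cong (Σℚ (map f (g b)) +_) (Σ-concatMap f g l) ⟩
    Σℚ (map f (g b)) + Σℚ (map (λ b → Σℚ (map f (g b))) l) ∎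

L-Σ : (F : List I → I′ → ℚ) (p : List (ℚ × List I)) (l : List I′) →
  L (λ v → Σℚ (map (F v) l)) p ≡ Σℚ (map (λ b → L (λ v → F v b) p) l)
L-Σ F p [] = L-0 p
L-Σ F p (b ∷ l) = trans (L-+ (λ v → F v b) _ p) (cong (L (λ v → F v b) p +_) (L-Σ F p l))

-- Equality of coefficients is equality under all linear functionals

infix 4 _≅_
record _≅_ (p q : Poly) : Set where
  constructor agree
  field at : ∀ φ → L φ p ≡ L φ q
open _≅_ public

≅-refl : {p : Poly} → p ≅ p
≅-refl = agree λ φ → refl

≅-sym : {p q : Poly} → p ≅ q → q ≅ p
≅-sym e = agree λ φ → sym (at e φ)

≅-trans : {p q r : Poly} → p ≅ q → q ≅ r → p ≅ r
≅-trans e e' = agree λ φ → trans (at e φ) (at e' φ)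

≟L-sound : (a b : Letter) → (a ≟L b) ≡ true → a ≡ b
≟L-sound X X e = refl
≟L-sound Y Y e = refl

∧-true : (a b : Bool) → (a ∧ b) ≡ true → (a ≡ true) × (b ≡ true)
∧-true true true e = refl , refl

≟W-sound : (v w : Word) → (v ≟W w) ≡ true → v ≡ w
≟W-sound [] [] e = refl
≟W-sound (a ∷ v) (b ∷ w) e with ∧-true (a ≟L b) (v ≟W w) e
... | e₁ , e₂ = cong₂ _∷_ (≟L-sound a b e₁) (≟W-sound v w e₂)

≟W-refl : (w : Word) → (w ≟W w) ≡ true
≟W-refl [] = refl
≟W-refl (X ∷ w) = ≟W-refl w
≟W-refl (Y ∷ w) = ≟W-refl w

δ : Word → Word → ℚ
δ w v = if v ≟W w then 1ℚ else 0ℚ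

coeff-L : (p : Poly) (w : Word) → coeff p w ≡ L (δ w) p
coeff-L [] w = refl
coeff-L ((c , v) ∷ p) w with v ≟W w
... | true = cong₂ _+_ (sym (*-identityʳ c)) (coeff-L p w)
... | false = cong₂ _+_ (sym (*-zeroʳ c)) (coeff-L p w)

≅⇒≈P : {p q : Poly} → p ≅ q → p ≈P q
≅⇒≈P {p} {q} e w = trans (coeff-L p w) (trans (at e (δ w)) (sym (coeff-L q w)))

others : Word → Poly → Poly
others w [] = []
others w ((c , v) ∷ r) = if v ≟W w then others w r else (c , v) ∷ others w r

L-split : (φ : Word → ℚ) (w : Word) (r : Poly) → L φ r ≡ L (δ w) r * φ w + L φ (others w r)
L-split φ w [] = sym (solve 1 (λ f → con 0ℚ :* f :+ con 0ℚ := con 0ℚ) refl (φ w))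
L-split φ w ((c , v) ∷ r) with v ≟W w in eq
... | true rewrite L-split φ w r | ≟W-sound v w eq =
  solve 4 (λ c f a b → c :* f :+ (a :* f :+ b) := (c :* con 1ℚ :+ a) :* f :+ b) refl c (φ w) (L (δ w) r) (L φ (others w r))
... | false rewrite L-split φ w r =
  solve 5 (λ c g a f b → c :* g :+ (a :* f :+ b) := (c :* con 0ℚ :+ a) :* f :+ (c :* g :+ b)) refl c (φ v) (L (δ w) r) (φ w) (L φ (others w r))

others-shorter : (c : ℚ) (w : Word) (r : Poly) → length (others w ((c , w) ∷ r)) ℕ.≤ length r
others-shorter c w r rewrite ≟W-refl w = shorter r
  where
  shorter : (r : Poly) → length (others w r) ℕ.≤ length r
  shorter [] = z≤n
  shorter ((d , v) ∷ r) with v ≟W w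
  ... | true = ℕP.m≤n⇒m≤1+n (shorter r)
  ... | false = s≤s (shorter r)

-- A combination all of whose coefficients vanish is killed by every
-- functional (induction on a bound n for the number of terms).
vanishing : (n : ℕ) (r : Poly) → length r ℕ.≤ n → (∀ v → L (δ v) r ≡ 0ℚ) → ∀ φ → L φ r ≡ 0ℚ
vanishing n [] _ _ φ = refl
vanishing (suc n) r₀@((c , w) ∷ r) (s≤s le) zero-coeffs φ = begin
    L φ r₀
  ≡⟨ L-split φ w r₀ ⟩
    L (δ w) r₀ * φ w + L φ (others w r₀)
  ≡⟨ cong₂ (λ a b → a * φ w + b) (zero-coeffs w) (vanishing n (others w r₀) (ℕP.≤-trans (others-shorter c w r) le) others-zero φ) ⟩
    0ℚ * φ w + 0ℚ
  ≡⟨ solve 1 (λ f → con 0ℚ :* f :+ con 0ℚ := con 0ℚ) refl (φ w) ⟩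
    0ℚ ∎
  where
  others-zero : ∀ v → L (δ v) (others w r₀) ≡ 0ℚ
  others-zero v = begin
      L (δ v) (others w r₀)
    ≡⟨ solve 2 (λ a b → b := a :* con 0ℚ :+ b) refl (δ v w) _ ⟩
      δ v w * 0ℚ + L (δ v) (others w r₀)
    ≡⟨ cong (λ a → δ v w * a + L (δ v) (others w r₀)) (sym (zero-coeffs w)) ⟩
      δ v w * L (δ w) r₀ + L (δ v) (others w r₀)
    ≡⟨ cong (_+ L (δ v) (others w r₀)) (*-comm (δ v w) _) ⟩
      L (δ w) r₀ * δ v w + L (δ v) (others w r₀)
    ≡⟨ sym (L-split (δ v) w r₀) ⟩
      L (δ v) r₀
    ≡⟨ zero-coeffs v ⟩
      0ℚ ∎

L-scaleP : (φ : Word → ℚ) (a : ℚ) (p : Poly) → L φ (scaleP a p) ≡ a * L φ p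
L-scaleP φ a p = trans (L-map φ (λ w → a * φ w) _ p (λ c w → scale-term a c φ w)) (L-* a φ p)

L-negP : (φ : Word → ℚ) (p : Poly) → L φ (-P p) ≡ - L φ p
L-negP φ p = trans (L-scaleP φ (- 1ℚ) p) (solve 1 (λ x → :- con 1ℚ :* x := :- x) refl (L φ p))

L-subP : (φ : Word → ℚ) (p q : Poly) → L φ (p -P q) ≡ L φ p + - L φ q
L-subP φ p q = trans (L-++ φ p (-P q)) (cong (L φ p +_) (L-negP φ q))

≈P⇒≅ : {p q : Poly} → p ≈P q → p ≅ q
≈P⇒≅ {p} {q} e = agree λ φ → x∙y⁻¹≈ε⇒x≈y _ _
  (trans (sym (L-subP φ p q)) (vanishing _ (p -P q) ℕP.≤-refl coeffs-vanish φ))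
  where
  coeffs-vanish : ∀ v → L (δ v) (p -P q) ≡ 0ℚ
  coeffs-vanish v = begin
      L (δ v) (p -P q)
    ≡⟨ L-subP (δ v) p q ⟩
      L (δ v) p + - L (δ v) q
    ≡⟨ cong₂ (λ a b → a + - b) (sym (coeff-L p v)) (trans (sym (coeff-L q v)) (sym (e v))) ⟩
      coeff p v + - coeff p v
    ≡⟨ +-inverseʳ (coeff p v) ⟩
      0ℚ ∎

L-mulP : (φ : Word → ℚ) (p q : Poly) → L φ (p *P q) ≡ L (λ v → L (λ w → φ (v ++ w)) q) p
L-mulP φ p q = L-concatMap φ _ _ p λ c v →
  trans (L-map φ (λ w → c * φ (v ++ w)) _ q (λ d w → row-term c d φ v w)) (L-* c (λ w → φ (v ++ w)) q)

L-wordP : (φ : Word → ℚ) (w : Word) → L φ (wordP w) ≡ φ w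
L-wordP φ w = trans (+-identityʳ _) (*-identityˡ _)

L-w* : (φ : Word → ℚ) (v : Word) (q : Poly) → L φ (wordP v *P q) ≡ L (λ w → φ (v ++ w)) q
L-w* φ v q = trans (L-mulP φ (wordP v) q) (L-wordP (λ v → L (λ w → φ (v ++ w)) q) v)

L-*w : (φ : Word → ℚ) (p : Poly) (w : Word) → L φ (p *P wordP w) ≡ L (λ v → φ (v ++ w)) p
L-*w φ p w = trans (L-mulP φ p (wordP w)) (L-cong p (λ v → L-wordP (λ t → φ (v ++ t)) w))

adL : (Word → ℚ) → Poly → ℚ
adL φ p = L (λ w → φ (X ∷ w)) p + - L (λ v → φ (v ++ X ∷ [])) p

L-br-x : (φ : Word → ℚ) (p : Poly) → L φ [ x̂ , p ]P ≡ adL φ p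
L-br-x φ p = trans (L-subP φ (x̂ *P p) (p *P x̂)) (cong₂ (λ a b → a + - b) (L-w* φ (X ∷ []) p) (L-*w φ p (X ∷ [])))

*-oneP : (p : Poly) → (p *P oneP) ≅ p
*-oneP p = agree λ φ → trans (L-*w φ p []) (L-cong p (λ v → cong φ (++-identityʳ v)))

++-cong : {p p' q q' : Poly} → p ≅ p' → q ≅ q' → (p ++ q) ≅ (p' ++ q')
++-cong {p} {p'} {q} {q'} e e' =
  agree λ φ → trans (L-++ φ p q) (trans (cong₂ _+_ (at e φ) (at e' φ)) (sym (L-++ φ p' q')))

neg-cong : {p q : Poly} → p ≅ q → (-P p) ≅ (-P q)
neg-cong {p} {q} e = agree λ φ → trans (L-negP φ p) (trans (cong -_ (at e φ)) (sym (L-negP φ q)))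

*-cong : {p p' q q' : Poly} → p ≅ p' → q ≅ q' → (p *P q) ≅ (p' *P q')
*-cong {p} {p'} {q} {q'} e e' = agree λ φ → begin
    L φ (p *P q)                          ≡⟨ L-mulP φ p q ⟩
    L (λ v → L (λ w → φ (v ++ w)) q) p    ≡⟨ L-cong p (λ v → at e' _) ⟩
    L (λ v → L (λ w → φ (v ++ w)) q') p   ≡⟨ at e _ ⟩
    L (λ v → L (λ w → φ (v ++ w)) q') p'  ≡⟨ sym (L-mulP φ p' q') ⟩
    L φ (p' *P q') ∎

br-cong : {p p' q q' : Poly} → p ≅ p' → q ≅ q' → [ p , q ]P ≅ [ p' , q' ]P
br-cong e e' = ++-cong (*-cong e e') (neg-cong (*-cong e' e))

-- ma h is a linear functional of the polynomial evalC h

Mon : List ℕ → Poly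
Mon ks = prodP (map Cidx ks)

L-evalC : (φ : Word → ℚ) (h : CPoly) → L φ (evalC h) ≡ L (λ ks → L φ (Mon ks)) h
L-evalC φ h = L-concatMap φ _ _ h (λ c ks → L-scaleP φ c (Mon ks))

smon : List ℕ → Mould
smon [] [] = 1ℚ
smon [] (_ ∷ _) = 0ℚ
smon (k ∷ ks) [] = 0ℚ
smon (k ∷ ks) (u ∷ us) = powℚ (- u) k * smon ks us

-- ψ z w u reads the word w from the left: each y consumes the next
-- variable u_i, each x contributes the factor -z where z = -(u₁+⋯+u_i)
-- accumulates the variables consumed so far; words of the wrong depth give 0.
ψ : ℚ → Word → List ℚ → ℚ
ψ z [] [] = 1ℚ
ψ z [] (_ ∷ _) = 0ℚ
ψ z (X ∷ w) u = (- z) * ψ z w u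
ψ z (Y ∷ w) [] = 0ℚ
ψ z (Y ∷ w) (u₁ ∷ us) = ψ (z + - u₁) w us

Ψ : ℚ → List ℚ → Poly → ℚ
Ψ z u q = L (λ w → ψ z w u) q

-- the value of ψ on C_{k+1} · q
ψC : ℕ → ℚ → List ℚ → Poly → ℚ
ψC k z [] q = 0ℚ
ψC k z (u₁ ∷ us) q = powℚ (- u₁) k * Ψ (z + - u₁) us q

ψ-Cidx : (k : ℕ) (z : ℚ) (u : List ℚ) (q : Poly) →
  L (λ v → L (λ w → ψ z (v ++ w) u) q) (Cidx k) ≡ ψC k z u q
ψ-Cidx zero z [] q = trans (+-identityʳ _) (trans (*-identityˡ _) (L-0 q))
ψ-Cidx zero z (u₁ ∷ us) q =
  trans (L-wordP (λ v → L (λ w → ψ z (v ++ w) (u₁ ∷ us)) q) (Y ∷ [])) (sym (*-identityˡ _))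
ψ-Cidx (suc k) z u q = begin
    L χ [ x̂ , Cidx k ]P
  ≡⟨ L-subP χ (x̂ *P Cidx k) (Cidx k *P x̂) ⟩
    L χ (x̂ *P Cidx k) + - L χ (Cidx k *P x̂)
  ≡⟨ cong₂ (λ a b → a + - b) x-on-left x-on-right ⟩
    (- z) * ψC k z u q + - ψC k z u (x̂ *P q)
  ≡⟨ bracket-step u ⟩
    ψC (suc k) z u q ∎
  where
  χ : Word → ℚ
  χ v = L (λ w → ψ z (v ++ w) u) q
  x-on-left : L χ (x̂ *P Cidx k) ≡ (- z) * ψC k z u q
  x-on-left = begin
      L χ (x̂ *P Cidx k)
    ≡⟨ L-w* χ (X ∷ []) (Cidx k) ⟩
      L (λ w → L (λ t → (- z) * ψ z (w ++ t) u) q) (Cidx k)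
    ≡⟨ L-cong (Cidx k) (λ w → L-* (- z) (λ t → ψ z (w ++ t) u) q) ⟩
      L (λ w → (- z) * χ w) (Cidx k)
    ≡⟨ L-* (- z) χ (Cidx k) ⟩
      (- z) * L χ (Cidx k)
    ≡⟨ cong ((- z) *_) (ψ-Cidx k z u q) ⟩
      (- z) * ψC k z u q ∎
  x-on-right : L χ (Cidx k *P x̂) ≡ ψC k z u (x̂ *P q)
  x-on-right = begin
      L χ (Cidx k *P x̂)
    ≡⟨ L-*w χ (Cidx k) (X ∷ []) ⟩
      L (λ v → χ (v ++ X ∷ [])) (Cidx k)
    ≡⟨ L-cong (Cidx k) (λ v → L-cong q (λ t → cong (λ s → ψ z s u) (++-assoc v (X ∷ []) t))) ⟩
      L (λ v → L (λ t → ψ z (v ++ X ∷ t) u) q) (Cidx k)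
    ≡⟨ L-cong (Cidx k) (λ v → sym (L-w* (λ t → ψ z (v ++ t) u) (X ∷ []) q)) ⟩
      L (λ v → L (λ w → ψ z (v ++ w) u) (x̂ *P q)) (Cidx k)
    ≡⟨ ψ-Cidx k z u (x̂ *P q) ⟩
      ψC k z u (x̂ *P q) ∎
  bracket-step : (u : List ℚ) → (- z) * ψC k z u q + - ψC k z u (x̂ *P q) ≡ ψC (suc k) z u q
  bracket-step [] = solve 1 (λ z → (:- z) :* con 0ℚ :+ :- con 0ℚ := con 0ℚ) refl z
  bracket-step (u₁ ∷ us) = begin
      (- z) * (P * Ψ z' us q) + - (P * Ψ z' us (x̂ *P q))
    ≡⟨ cong (λ a → (- z) * (P * Ψ z' us q) + - (P * a))
         (trans (L-w* (λ w → ψ z' w us) (X ∷ []) q) (L-* (- z') (λ w → ψ z' w us) q)) ⟩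
      (- z) * (P * Ψ z' us q) + - (P * ((- z') * Ψ z' us q))
    ≡⟨ solve 4 (λ z u P Q → (:- z) :* (P :* Q) :+ :- (P :* ((:- (z :+ :- u)) :* Q))
                          := ((:- u) :* P) :* Q) refl z u₁ P (Ψ z' us q) ⟩
      ((- u₁) * P) * Ψ z' us q ∎
    where
    P = powℚ (- u₁) k
    z' = z + - u₁

ψ-Mon : (ks : List ℕ) (z : ℚ) (u : List ℚ) → Ψ z u (Mon ks) ≡ smon ks u
ψ-Mon [] z [] = L-wordP (λ w → ψ z w []) []
ψ-Mon [] z (u ∷ us) = L-wordP (λ w → ψ z w (u ∷ us)) []
ψ-Mon (k ∷ ks) z [] = trans (L-mulP _ (Cidx k) (Mon ks)) (ψ-Cidx k z [] (Mon ks))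
ψ-Mon (k ∷ ks) z (u₁ ∷ us) = trans (L-mulP _ (Cidx k) (Mon ks))
  (trans (ψ-Cidx k z (u₁ ∷ us) (Mon ks)) (cong (powℚ (- u₁) k *_) (ψ-Mon ks (z + - u₁) us)))

-- The sign (-1)^{r+n} of ma turns u^k into (-u)^k, since r + n ≡ Σ kᵢ (mod 2).
sign-+ : (m n : ℕ) → signℚ (m ℕ.+ n) ≡ signℚ m * signℚ n
sign-+ zero n = sym (*-identityˡ _)
sign-+ (suc zero) zero = refl
sign-+ (suc zero) (suc zero) = refl
sign-+ (suc zero) (suc (suc n)) = sign-+ 1 n
sign-+ (suc (suc m)) n = sign-+ m n

pow-neg : (u : ℚ) (k : ℕ) → powℚ (- u) k ≡ signℚ k * powℚ u k
pow-neg u zero = refl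
pow-neg u (suc zero) = solve 1 (λ u → :- u :* con 1ℚ := :- con 1ℚ :* (u :* con 1ℚ)) refl u
pow-neg u (suc (suc k)) rewrite pow-neg u k =
  solve 3 (λ u s p → :- u :* (:- u :* (s :* p)) := s :* (u :* (u :* p))) refl u (signℚ k) (powℚ u k)

length+degree-cons : (r k n : ℕ) → suc r ℕ.+ (suc k ℕ.+ n) ≡ suc (suc (k ℕ.+ (r ℕ.+ n)))
length+degree-cons r k n = cong suc (trans (ℕP.+-suc r (k ℕ.+ n)) (cong suc
  (trans (sym (ℕP.+-assoc r k n)) (trans (cong (ℕ._+ n) (ℕP.+-comm r k)) (ℕP.+-assoc k r n)))))

sign-monM : (ks : List ℕ) (u : List ℚ) →
  signℚ (length ks ℕ.+ ListAction.sum (map suc ks)) * monM ks u ≡ smon ks u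
sign-monM [] [] = refl
sign-monM [] (_ ∷ _) = refl
sign-monM (k ∷ ks) [] = *-zeroʳ (signℚ (length (k ∷ ks) ℕ.+ ListAction.sum (map suc (k ∷ ks))))
sign-monM (k ∷ ks) (u ∷ us) = begin
    signℚ (suc (length ks) ℕ.+ (suc k ℕ.+ ListAction.sum (map suc ks))) * (powℚ u k * monM ks us)
  ≡⟨ cong (λ n → signℚ n * (powℚ u k * monM ks us)) (length+degree-cons (length ks) k _) ⟩
    signℚ (k ℕ.+ (length ks ℕ.+ ListAction.sum (map suc ks))) * (powℚ u k * monM ks us)
  ≡⟨ cong (_* (powℚ u k * monM ks us)) (sign-+ k _) ⟩
    signℚ k * s * (powℚ u k * monM ks us)
  ≡⟨ solve 4 (λ a b c d → a :* b :* (c :* d) := (a :* c) :* (b :* d)) refl (signℚ k) s (powℚ u k) (monM ks us) ⟩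
    (signℚ k * powℚ u k) * (s * monM ks us)
  ≡⟨ cong₂ _*_ (sym (pow-neg u k)) (sign-monM ks us) ⟩
    powℚ (- u) k * smon ks us ∎
  where s = signℚ (length ks ℕ.+ ListAction.sum (map suc ks))

mould : CPoly → Mould
mould h u = L (λ ks → smon ks u) h

ma≡mould : (h : CPoly) (u : List ℚ) → ma h u ≡ mould h u
ma≡mould [] u = refl
ma≡mould ((c , ks) ∷ h) u = cong₂ _+_ term (ma≡mould h u)
  where
  term : maTerm (c , ks) u ≡ c * smon ks u
  term = trans (solve 3 (λ s c m → s :* c :* m := c :* (s :* m)) refl (signℚ (length ks ℕ.+ ListAction.sum (map suc ks))) c (monM ks u))
    (cong (c *_) (sign-monM ks u))

ma-ψ : (h : CPoly) (u : List ℚ) → ma h u ≡ Ψ 0ℚ u (evalC h)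
ma-ψ h u = begin
    ma h u                                  ≡⟨ ma≡mould h u ⟩
    L (λ ks → smon ks u) h                  ≡⟨ L-cong h (λ ks → sym (ψ-Mon ks 0ℚ u)) ⟩
    L (λ ks → Ψ 0ℚ u (Mon ks)) h            ≡⟨ sym (L-evalC _ h) ⟩
    Ψ 0ℚ u (evalC h) ∎

ma-respects-≅ : (h h' : CPoly) → evalC h ≅ evalC h' → ma h ≈M ma h'
ma-respects-≅ h h' e u = trans (ma-ψ h u) (trans (at e _) (sym (ma-ψ h' u)))

cscale : ℚ → CPoly → CPoly
cscale a = map (λ { (c , ks) → (a * c , ks) })

cneg : CPoly → CPoly
cneg = cscale (- 1ℚ)

cmul : CPoly → CPoly → CPoly
cmul f g = concatMap (λ { (c , ks) → map (λ { (d , ls) → (c * d , ks ++ ls) }) g }) f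

cmon : List ℕ → CPoly
cmon ks = (1ℚ , ks) ∷ []

-- [x, C_{k₁+1}⋯C_{k_r+1}] = Σ_i C_{k₁+1}⋯C_{kᵢ+2}⋯C_{k_r+1}: raise one index
raise : List ℕ → List (List ℕ)
raise [] = []
raise (k ∷ ks) = (suc k ∷ ks) ∷ map (k ∷_) (raise ks)

adC : CPoly → CPoly
adC h = concatMap (λ { (c , ks) → map (λ ks' → (c , ks')) (raise ks) }) h

adC^ : ℕ → CPoly → CPoly
adC^ zero h = h
adC^ (suc k) h = adC (adC^ k h)

brC₁ : CPoly → CPoly
brC₁ f = cmul (cmon (0 ∷ [])) f ++ cneg (cmul f (cmon (0 ∷ [])))

-- D_f on a monomial, via D_f(C_{k+1}) = ad(x)^k [C₁, f] and the Leibniz rule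
cD-mon : CPoly → List ℕ → CPoly
cD-mon f [] = []
cD-mon f (k ∷ ks) = cmul (adC^ k (brC₁ f)) (cmon ks) ++ cmul (cmon (k ∷ [])) (cD-mon f ks)

cD : CPoly → CPoly → CPoly
cD f g = concatMap (λ { (d , ks) → cscale d (cD-mon f ks) }) g

cpoisson : CPoly → CPoly → CPoly
cpoisson f g = cmul f g ++ (cneg (cmul g f) ++ (cD f g ++ cneg (cD g f)))

L-cscale : (Ξ : List ℕ → ℚ) (a : ℚ) (h : CPoly) → L Ξ (cscale a h) ≡ a * L Ξ h
L-cscale Ξ a h = trans (L-map Ξ (λ ks → a * Ξ ks) _ h (λ c ks → scale-term a c Ξ ks)) (L-* a Ξ h)

L-cneg : (Ξ : List ℕ → ℚ) (h : CPoly) → L Ξ (cneg h) ≡ - L Ξ h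
L-cneg Ξ h = trans (L-cscale Ξ (- 1ℚ) h) (solve 1 (λ x → :- con 1ℚ :* x := :- x) refl (L Ξ h))

L-cmul : (Ξ : List ℕ → ℚ) (f g : CPoly) → L Ξ (cmul f g) ≡ L (λ ks → L (λ ls → Ξ (ks ++ ls)) g) f
L-cmul Ξ f g = L-concatMap Ξ _ _ f λ c ks →
  trans (L-map Ξ (λ ls → c * Ξ (ks ++ ls)) _ g (λ d ls → row-term c d Ξ ks ls)) (L-* c (λ ls → Ξ (ks ++ ls)) g)

L-cmon : (Ξ : List ℕ → ℚ) (ks : List ℕ) → L Ξ (cmon ks) ≡ Ξ ks
L-cmon Ξ ks = trans (+-identityʳ _) (*-identityˡ _)

L-adC : (Ξ : List ℕ → ℚ) (h : CPoly) → L Ξ (adC h) ≡ L (λ ks → Σℚ (map Ξ (raise ks))) h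
L-adC Ξ h = L-concatMap Ξ _ _ h (λ c ks → same-coefficient c (raise ks))
  where
  same-coefficient : (c : ℚ) (l : List (List ℕ)) → L Ξ (map (λ ks' → (c , ks')) l) ≡ c * Σℚ (map Ξ l)
  same-coefficient c [] = sym (*-zeroʳ c)
  same-coefficient c (ks ∷ l) =
    trans (cong (c * Ξ ks +_) (same-coefficient c l)) (sym (*-distribˡ-+ c (Ξ ks) _))

L-cD : (Ξ : List ℕ → ℚ) (f g : CPoly) → L Ξ (cD f g) ≡ L (λ ks → L Ξ (cD-mon f ks)) g
L-cD Ξ f g = L-concatMap Ξ _ _ g (λ d ks → L-cscale Ξ d (cD-mon f ks))

Ev : (Word → ℚ) → List ℕ → ℚ
Ev φ ks = L φ (Mon ks)

evalC-++ : (f g : CPoly) → evalC (f ++ g) ≅ (evalC f ++ evalC g)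
evalC-++ f g = agree λ φ → begin
    L φ (evalC (f ++ g))              ≡⟨ L-evalC φ (f ++ g) ⟩
    L (Ev φ) (f ++ g)                 ≡⟨ L-++ (Ev φ) f g ⟩
    L (Ev φ) f + L (Ev φ) g           ≡⟨ cong₂ _+_ (sym (L-evalC φ f)) (sym (L-evalC φ g)) ⟩
    L φ (evalC f) + L φ (evalC g)     ≡⟨ sym (L-++ φ (evalC f) (evalC g)) ⟩
    L φ (evalC f ++ evalC g) ∎

evalC-neg : (f : CPoly) → evalC (cneg f) ≅ (-P evalC f)
evalC-neg f = agree λ φ → begin
    L φ (evalC (cneg f))              ≡⟨ L-evalC φ (cneg f) ⟩
    L (Ev φ) (cneg f)                 ≡⟨ L-cneg (Ev φ) f ⟩
    - L (Ev φ) f                      ≡⟨ cong -_ (sym (L-evalC φ f)) ⟩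
    - L φ (evalC f)                   ≡⟨ sym (L-negP φ (evalC f)) ⟩
    L φ (-P evalC f) ∎

evalC-cmon : (ks : List ℕ) → evalC (cmon ks) ≅ Mon ks
evalC-cmon ks = agree λ φ → trans (L-evalC φ (cmon ks)) (L-cmon (Ev φ) ks)

evalC-C₁ : evalC (cmon (0 ∷ [])) ≅ ŷ
evalC-C₁ = ≅-trans (evalC-cmon (0 ∷ [])) (*-oneP ŷ)

Ev-++ : (ks ls : List ℕ) (φ : Word → ℚ) →
  Ev φ (ks ++ ls) ≡ L (λ v → L (λ w → φ (v ++ w)) (Mon ls)) (Mon ks)
Ev-++ [] ls φ = sym (L-wordP (λ v → L (λ w → φ (v ++ w)) (Mon ls)) [])
Ev-++ (k ∷ ks) ls φ = begin
    L φ (Cidx k *P Mon (ks ++ ls))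
  ≡⟨ L-mulP φ (Cidx k) (Mon (ks ++ ls)) ⟩
    L (λ v → Ev (λ w → φ (v ++ w)) (ks ++ ls)) (Cidx k)
  ≡⟨ L-cong (Cidx k) (λ v → Ev-++ ks ls (λ w → φ (v ++ w))) ⟩
    L (λ v → L (λ v' → L (λ w → φ (v ++ (v' ++ w))) (Mon ls)) (Mon ks)) (Cidx k)
  ≡⟨ L-cong (Cidx k) (λ v → L-cong (Mon ks) (λ v' → L-cong (Mon ls) (λ w → cong φ (sym (++-assoc v v' w))))) ⟩
    L (λ v → L (λ v' → L (λ w → φ ((v ++ v') ++ w)) (Mon ls)) (Mon ks)) (Cidx k)
  ≡⟨ sym (L-mulP _ (Cidx k) (Mon ks)) ⟩
    L (λ v → L (λ w → φ (v ++ w)) (Mon ls)) (Cidx k *P Mon ks) ∎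

evalC-cmul : (f g : CPoly) → evalC (cmul f g) ≅ (evalC f *P evalC g)
evalC-cmul f g = agree λ φ → begin
    L φ (evalC (cmul f g))
  ≡⟨ trans (L-evalC φ (cmul f g)) (L-cmul (Ev φ) f g) ⟩
    L (λ ks → L (λ ls → Ev φ (ks ++ ls)) g) f
  ≡⟨ L-cong f (λ ks → L-cong g (λ ls → Ev-++ ks ls φ)) ⟩
    L (λ ks → L (λ ls → L (λ v → L (λ w → φ (v ++ w)) (Mon ls)) (Mon ks)) g) f
  ≡⟨ L-cong f (λ ks → sym (L-swap (λ v ls → L (λ w → φ (v ++ w)) (Mon ls)) (Mon ks) g)) ⟩
    L (λ ks → L (λ v → L (λ ls → L (λ w → φ (v ++ w)) (Mon ls)) g) (Mon ks)) f
  ≡⟨ L-cong f (λ ks → L-cong (Mon ks) (λ v → sym (L-evalC (λ w → φ (v ++ w)) g))) ⟩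
    L (λ ks → L (λ v → L (λ w → φ (v ++ w)) (evalC g)) (Mon ks)) f
  ≡⟨ sym (L-evalC _ f) ⟩
    L (λ v → L (λ w → φ (v ++ w)) (evalC g)) (evalC f)
  ≡⟨ sym (L-mulP φ (evalC f) (evalC g)) ⟩
    L φ (evalC f *P evalC g) ∎

-- raising one index of a monomial in all ways is ad(x): by induction, using
-- [x, C_{k+1} M] = C_{k+2} M + C_{k+1} [x, M].
raise-adx : (ks : List ℕ) (φ : Word → ℚ) → Σℚ (map (Ev φ) (raise ks)) ≡ adL φ (Mon ks)
raise-adx [] φ = solve 1 (λ a → con 0ℚ := con 1ℚ :* a :+ con 0ℚ :+ :- (con 1ℚ :* a :+ con 0ℚ)) refl (φ (X ∷ []))
raise-adx (k ∷ ks) φ = begin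
    Ev φ (suc k ∷ ks) + Σℚ (map (Ev φ) (map (k ∷_) (raise ks)))
  ≡⟨ cong₂ _+_ raise-first raise-rest ⟩
    (a + - b) + (b + - c)
  ≡⟨ solve 3 (λ a b c → (a :+ :- b) :+ (b :+ :- c) := a :+ :- c) refl a b c ⟩
    a + - c
  ≡⟨ sym adx-product ⟩
    adL φ (Cidx k *P Mon ks) ∎
  where
  M = Mon ks
  Ck = Cidx k
  a = L (λ v → L (λ w → φ (X ∷ v ++ w)) M) Ck
  b = L (λ v → L (λ w → φ (v ++ X ∷ w)) M) Ck
  c = L (λ v → L (λ w → φ (v ++ (w ++ X ∷ []))) M) Ck
  raise-first : Ev φ (suc k ∷ ks) ≡ a + - b
  raise-first = begin
      L φ ([ x̂ , Ck ]P *P M)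
    ≡⟨ L-mulP φ [ x̂ , Ck ]P M ⟩
      L (λ v → L (λ w → φ (v ++ w)) M) [ x̂ , Ck ]P
    ≡⟨ L-br-x _ Ck ⟩
      a + - L (λ v → L (λ w → φ ((v ++ X ∷ []) ++ w)) M) Ck
    ≡⟨ cong (λ t → a + - t) (L-cong Ck (λ v → L-cong M (λ w → cong φ (++-assoc v (X ∷ []) w)))) ⟩
      a + - b ∎
  raise-rest : Σℚ (map (Ev φ) (map (k ∷_) (raise ks))) ≡ b + - c
  raise-rest = begin
      Σℚ (map (Ev φ) (map (k ∷_) (raise ks)))
    ≡⟨ Σ-map (Ev φ) (k ∷_) (raise ks) ⟩
      Σℚ (map (λ ks' → Ev φ (k ∷ ks')) (raise ks))
    ≡⟨ Σ-cong (raise ks) (λ ks' → L-mulP φ Ck (Mon ks')) ⟩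
      Σℚ (map (λ ks' → L (λ v → Ev (λ w → φ (v ++ w)) ks') Ck) (raise ks))
    ≡⟨ sym (L-Σ (λ v ks' → Ev (λ w → φ (v ++ w)) ks') Ck (raise ks)) ⟩
      L (λ v → Σℚ (map (Ev (λ w → φ (v ++ w))) (raise ks))) Ck
    ≡⟨ L-cong Ck (λ v → raise-adx ks (λ w → φ (v ++ w))) ⟩
      L (λ v → L (λ w → φ (v ++ X ∷ w)) M + - L (λ w → φ (v ++ (w ++ X ∷ []))) M) Ck
    ≡⟨ L-+ _ _ Ck ⟩
      b + L (λ v → - L (λ w → φ (v ++ (w ++ X ∷ []))) M) Ck
    ≡⟨ cong (b +_) (L-neg _ Ck) ⟩
      b + - c ∎
  adx-product : adL φ (Ck *P M) ≡ a + - c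
  adx-product = cong₂ (λ s t → s + - t) (L-mulP (λ w → φ (X ∷ w)) Ck M)
    (trans (L-mulP (λ v → φ (v ++ X ∷ [])) Ck M) (L-cong Ck (λ v → L-cong M (λ w → cong φ (++-assoc v w (X ∷ []))))))

evalC-adC : (h : CPoly) → evalC (adC h) ≅ [ x̂ , evalC h ]P
evalC-adC h = agree λ φ → begin
    L φ (evalC (adC h))
  ≡⟨ trans (L-evalC φ (adC h)) (L-adC (Ev φ) h) ⟩
    L (λ ks → Σℚ (map (Ev φ) (raise ks))) h
  ≡⟨ L-cong h (λ ks → raise-adx ks φ) ⟩
    L (λ ks → adL φ (Mon ks)) h
  ≡⟨ L-+ _ _ h ⟩
    L (Ev (λ w → φ (X ∷ w))) h + L (λ ks → - Ev (λ v → φ (v ++ X ∷ [])) ks) h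
  ≡⟨ cong₂ _+_ (sym (L-evalC _ h)) (trans (L-neg _ h) (cong -_ (sym (L-evalC _ h)))) ⟩
    adL φ (evalC h)
  ≡⟨ sym (L-br-x φ (evalC h)) ⟩
    L φ [ x̂ , evalC h ]P ∎

L-D : (φ : Word → ℚ) (F p : Poly) → L φ (D F p) ≡ L (λ w → L φ (D-word F w)) p
L-D φ F p = L-concatMap φ _ _ p (λ c w → L-scaleP φ c (D-word F w))

D-word-++ : (F : Poly) (v w : Word) (φ : Word → ℚ) →
  L φ (D-word F (v ++ w)) ≡ L (λ t → φ (t ++ w)) (D-word F v) + L (λ t → φ (v ++ t)) (D-word F w)
D-word-++ F [] w φ = sym (+-identityˡ _)
D-word-++ F (l ∷ v) w φ = begin
    L φ ((D-letter F l *P wordP (v ++ w)) ++ (wordP (l ∷ []) *P D-word F (v ++ w)))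
  ≡⟨ L-++ φ (D-letter F l *P wordP (v ++ w)) (wordP (l ∷ []) *P D-word F (v ++ w)) ⟩
    L φ (D-letter F l *P wordP (v ++ w)) + L φ (wordP (l ∷ []) *P D-word F (v ++ w))
  ≡⟨ cong₂ _+_ (L-*w φ (D-letter F l) (v ++ w))
       (trans (L-w* φ (l ∷ []) (D-word F (v ++ w))) (D-word-++ F v w (λ b → φ (l ∷ b)))) ⟩
    A₁ + (B₁ + C₁)
  ≡⟨ sym (+-assoc A₁ B₁ C₁) ⟩
    (A₁ + B₁) + C₁
  ≡⟨ cong (_+ C₁) (sym first-letter) ⟩
    L (λ t → φ (t ++ w)) (D-word F (l ∷ v)) + C₁ ∎
  where
  A₁ = L (λ a → φ (a ++ v ++ w)) (D-letter F l)
  B₁ = L (λ t → φ (l ∷ t ++ w)) (D-word F v)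
  C₁ = L (λ t → φ (l ∷ v ++ t)) (D-word F w)
  first-letter : L (λ t → φ (t ++ w)) (D-word F (l ∷ v)) ≡ A₁ + B₁
  first-letter = trans (L-++ _ (D-letter F l *P wordP v) (wordP (l ∷ []) *P D-word F v))
    (cong₂ _+_ (trans (L-*w _ (D-letter F l) v) (L-cong (D-letter F l) (λ a → cong φ (++-assoc a v w))))
               (L-w* _ (l ∷ []) (D-word F v)))

D-oneP : (F : Poly) → D F oneP ≅ []
D-oneP F = agree λ φ → trans (L-D φ F oneP) (solve 0 (con 1ℚ :* con 0ℚ :+ con 0ℚ := con 0ℚ) refl)

D-ŷ : (F : Poly) → D F ŷ ≅ [ ŷ , F ]P
D-ŷ F = agree λ φ → begin
    L φ (D F ŷ)
  ≡⟨ trans (L-D φ F ŷ) (L-wordP (λ w → L φ (D-word F w)) (Y ∷ [])) ⟩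
    L φ (([ ŷ , F ]P *P wordP []) ++ [])
  ≡⟨ trans (L-++ φ ([ ŷ , F ]P *P wordP []) []) (+-identityʳ _) ⟩
    L φ ([ ŷ , F ]P *P wordP [])
  ≡⟨ at (*-oneP [ ŷ , F ]P) φ ⟩
    L φ [ ŷ , F ]P ∎

-- D_F commutes with ad(x), since D_F(x) = 0
D-br-x : (F p : Poly) → D F [ x̂ , p ]P ≅ [ x̂ , D F p ]P
D-br-x F p = agree λ φ → begin
    L φ (D F [ x̂ , p ]P)
  ≡⟨ trans (L-D φ F [ x̂ , p ]P) (L-br-x _ p) ⟩
    L (λ w → L φ (D-word F (X ∷ w))) p + - L (λ v → L φ (D-word F (v ++ X ∷ []))) p
  ≡⟨ cong₂ (λ a b → a + - b) (L-cong p (λ w → L-w* φ (X ∷ []) (D-word F w)))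
        (L-cong p (λ v → trans (D-word-++ F v (X ∷ []) φ) (+-identityʳ _))) ⟩
    L (λ w → L (λ t → φ (X ∷ t)) (D-word F w)) p + - L (λ v → L (λ t → φ (t ++ X ∷ [])) (D-word F v)) p
  ≡⟨ cong₂ (λ a b → a + - b) (sym (L-D _ F p)) (sym (L-D _ F p)) ⟩
    adL φ (D F p)
  ≡⟨ sym (L-br-x φ (D F p)) ⟩
    L φ [ x̂ , D F p ]P ∎

D-mul : (F p q : Poly) → D F (p *P q) ≅ ((D F p *P q) ++ (p *P D F q))
D-mul F p q = agree λ φ → begin
    L φ (D F (p *P q))
  ≡⟨ trans (L-D φ F (p *P q)) (L-mulP _ p q) ⟩
    L (λ v → L (λ w → L φ (D-word F (v ++ w))) q) p
  ≡⟨ L-cong p (λ v → trans (L-cong q (λ w → D-word-++ F v w φ)) (L-+ _ _ q)) ⟩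
    L (λ v → L (λ w → L (λ t → φ (t ++ w)) (D-word F v)) q + L (λ w → L (λ t → φ (v ++ t)) (D-word F w)) q) p
  ≡⟨ L-+ _ _ p ⟩
    L (λ v → L (λ w → L (λ t → φ (t ++ w)) (D-word F v)) q) p + L (λ v → L (λ w → L (λ t → φ (v ++ t)) (D-word F w)) q) p
  ≡⟨ cong₂ _+_ (derive-left φ) (trans (L-cong p (λ v → sym (L-D _ F q))) (sym (L-mulP φ p (D F q)))) ⟩
    L φ (D F p *P q) + L φ (p *P D F q)
  ≡⟨ sym (L-++ φ (D F p *P q) (p *P D F q)) ⟩
    L φ ((D F p *P q) ++ (p *P D F q)) ∎
  where
  derive-left : (φ : Word → ℚ) → L (λ v → L (λ w → L (λ t → φ (t ++ w)) (D-word F v)) q) p ≡ L φ (D F p *P q)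
  derive-left φ = begin
      L (λ v → L (λ w → L (λ t → φ (t ++ w)) (D-word F v)) q) p
    ≡⟨ L-cong p (λ v → sym (L-swap (λ t w → φ (t ++ w)) (D-word F v) q)) ⟩
      L (λ v → L (λ t → L (λ w → φ (t ++ w)) q) (D-word F v)) p
    ≡⟨ sym (L-D _ F p) ⟩
      L (λ t → L (λ w → φ (t ++ w)) q) (D F p)
    ≡⟨ sym (L-mulP φ (D F p) q) ⟩
      L φ (D F p *P q) ∎

module _ (f : CPoly) where
  private F = evalC f

  evalC-brC₁ : evalC (brC₁ f) ≅ [ ŷ , F ]P
  evalC-brC₁ = ≅-trans (evalC-++ (cmul (cmon (0 ∷ [])) f) (cneg (cmul f (cmon (0 ∷ [])))))
    (++-cong (≅-trans (evalC-cmul (cmon (0 ∷ [])) f) (*-cong evalC-C₁ (≅-refl {F})))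
             (≅-trans (evalC-neg (cmul f (cmon (0 ∷ [])))) (neg-cong (≅-trans (evalC-cmul f (cmon (0 ∷ []))) (*-cong (≅-refl {F}) evalC-C₁)))))

  D-Cidx : (k : ℕ) → D F (Cidx k) ≅ evalC (adC^ k (brC₁ f))
  D-Cidx zero = ≅-trans (D-ŷ F) (≅-sym evalC-brC₁)
  D-Cidx (suc k) = ≅-trans (D-br-x F (Cidx k)) (≅-trans (br-cong ≅-refl (D-Cidx k)) (≅-sym (evalC-adC (adC^ k (brC₁ f)))))

  D-Mon : (ks : List ℕ) → D F (Mon ks) ≅ evalC (cD-mon f ks)
  D-Mon [] = D-oneP F
  D-Mon (k ∷ ks) = ≅-trans (D-mul F (Cidx k) (Mon ks)) (≅-sym (≅-trans
    (evalC-++ (cmul (adC^ k (brC₁ f)) (cmon ks)) (cmul (cmon (k ∷ [])) (cD-mon f ks)))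
    (++-cong (≅-trans (evalC-cmul (adC^ k (brC₁ f)) (cmon ks)) (*-cong (≅-sym (D-Cidx k)) (evalC-cmon ks)))
             (≅-trans (evalC-cmul (cmon (k ∷ [])) (cD-mon f ks)) (*-cong Ck (≅-sym (D-Mon ks)))))))
    where
    Ck : evalC (cmon (k ∷ [])) ≅ Cidx k
    Ck = ≅-trans (evalC-cmon (k ∷ [])) (*-oneP (Cidx k))

  evalC-cD : (g : CPoly) → evalC (cD f g) ≅ D F (evalC g)
  evalC-cD g = agree λ φ → begin
      L φ (evalC (cD f g))
    ≡⟨ trans (L-evalC φ (cD f g)) (L-cD (Ev φ) f g) ⟩
      L (λ ks → L (Ev φ) (cD-mon f ks)) g
    ≡⟨ L-cong g (λ ks → trans (sym (L-evalC φ (cD-mon f ks))) (sym (at (D-Mon ks) φ))) ⟩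
      L (λ ks → L φ (D F (Mon ks))) g
    ≡⟨ L-cong g (λ ks → L-D φ F (Mon ks)) ⟩
      L (λ ks → L (λ w → L φ (D-word F w)) (Mon ks)) g
    ≡⟨ sym (L-evalC _ g) ⟩
      L (λ w → L φ (D-word F w)) (evalC g)
    ≡⟨ sym (L-D φ F (evalC g)) ⟩
      L φ (D F (evalC g)) ∎

evalC-cpoisson : (f g : CPoly) → evalC (cpoisson f g) ≅ poisson (evalC f) (evalC g)
evalC-cpoisson f g =
  ≅-trans (evalC-++ (cmul f g) _)
  (≅-trans (++-cong (evalC-cmul f g) (≅-trans (evalC-++ (cneg (cmul g f)) _)
     (++-cong (≅-trans (evalC-neg (cmul g f)) (neg-cong (evalC-cmul g f)))
       (≅-trans (evalC-++ (cD f g) _) (++-cong (evalC-cD f g) (≅-trans (evalC-neg (cD g f)) (neg-cong (evalC-cD g f))))))))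
  (agree λ φ → cong (L φ) (sym (trans (++-assoc ((F *P G) ++ (-P (G *P F))) (D F G) (-P D G F))
                                      (++-assoc (F *P G) (-P (G *P F)) (D F G ++ (-P D G F)))))))
  where
  F = evalC f
  G = evalC g


-- Σsplit F w = Σ_{a ++ b = w} F a b ;  so mu A B = Σsplit (λ a b → A a * B b)
Σsplit : (List I → List I → ℚ) → List I → ℚ
Σsplit F w = Σℚ (map (λ s → F (proj₁ s) (proj₂ s)) (splits w))

Σsplit3 : (List I × List I × List I → ℚ) → List I → ℚ
Σsplit3 F w = Σℚ (map F (splits3 w))

Σsplit-cons : (F : List I → List I → ℚ) (x : I) (xs : List I) →
  Σsplit F (x ∷ xs) ≡ F [] (x ∷ xs) + Σsplit (λ a b → F (x ∷ a) b) xs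
Σsplit-cons F x xs = cong (F [] (x ∷ xs) +_) (Σ-map (λ s → F (proj₁ s) (proj₂ s)) _ (splits xs))

Σsplit-cong : {F G : List I → List I → ℚ} (w : List I) → (∀ a b → F a b ≡ G a b) → Σsplit F w ≡ Σsplit G w
Σsplit-cong w e = Σ-cong (splits w) (λ s → e (proj₁ s) (proj₂ s))

Σsplit-+ : (F G : List I → List I → ℚ) (w : List I) → Σsplit (λ a b → F a b + G a b) w ≡ Σsplit F w + Σsplit G w
Σsplit-+ F G w = Σ-+ (λ s → F (proj₁ s) (proj₂ s)) (λ s → G (proj₁ s) (proj₂ s)) (splits w)

Σsplit-* : (c : ℚ) (F : List I → List I → ℚ) (w : List I) → Σsplit (λ a b → c * F a b) w ≡ c * Σsplit F w
Σsplit-* c F w = Σ-* c (λ s → F (proj₁ s) (proj₂ s)) (splits w)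

Σsplit-neg : (F : List I → List I → ℚ) (w : List I) → Σsplit (λ a b → - F a b) w ≡ - Σsplit F w
Σsplit-neg F w = Σ-neg (λ s → F (proj₁ s) (proj₂ s)) (splits w)

Σsplit-0 : {F : List I → List I → ℚ} (w : List I) → (∀ a b → F a b ≡ 0ℚ) → Σsplit F w ≡ 0ℚ
Σsplit-0 w e = Σ-0 (splits w) (λ s → e (proj₁ s) (proj₂ s))

Σsplit⁺ : (List I → List I → ℚ) → List I → ℚ
Σsplit⁺ F [] = 0ℚ
Σsplit⁺ F (y ∷ ys) = Σsplit (λ a b → F (y ∷ a) b) ys

Σsplit-head : (F : List I → List I → ℚ) (w : List I) → Σsplit F w ≡ F [] w + Σsplit⁺ F w
Σsplit-head F [] = refl
Σsplit-head F (y ∷ ys) = Σsplit-cons F y ys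

Σsplit⁺-cong : {F G : List I → List I → ℚ} (w : List I) →
  (∀ y a b → F (y ∷ a) b ≡ G (y ∷ a) b) → Σsplit⁺ F w ≡ Σsplit⁺ G w
Σsplit⁺-cong [] e = refl
Σsplit⁺-cong (y ∷ ys) e = Σsplit-cong ys (λ a b → e y a b)

Σsplit⁺-0 : {F : List I → List I → ℚ} (w : List I) → (∀ y a b → F (y ∷ a) b ≡ 0ℚ) → Σsplit⁺ F w ≡ 0ℚ
Σsplit⁺-0 [] e = refl
Σsplit⁺-0 (y ∷ ys) e = Σsplit-0 ys (λ a b → e y a b)

grow : (List I → List I → ℚ) → List I → List I → ℚ
grow H a [] = 0ℚ
grow H a (c₁ ∷ c) = H (a ++ c₁ ∷ []) c

Σsplit-grow : (H : List I → List I → ℚ) (w : List I) → Σsplit H w ≡ H [] w + Σsplit (grow H) w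
Σsplit-grow H [] = sym (cong (H [] [] +_) (+-identityʳ 0ℚ))
Σsplit-grow H (y ∷ ys) = begin
    Σsplit H (y ∷ ys)
  ≡⟨ Σsplit-cons H y ys ⟩
    H [] (y ∷ ys) + Σsplit H' ys
  ≡⟨ cong (H [] (y ∷ ys) +_) (Σsplit-grow H' ys) ⟩
    H [] (y ∷ ys) + (H' [] ys + Σsplit (grow H') ys)
  ≡⟨ cong (λ t → H [] (y ∷ ys) + (H' [] ys + t)) (Σsplit-cong ys grow-cons) ⟩
    H [] (y ∷ ys) + (grow H [] (y ∷ ys) + Σsplit (λ b c → grow H (y ∷ b) c) ys)
  ≡⟨ cong (H [] (y ∷ ys) +_) (sym (Σsplit-cons (grow H) y ys)) ⟩
    H [] (y ∷ ys) + Σsplit (grow H) (y ∷ ys) ∎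
  where
  H' : List _ → List _ → ℚ
  H' e c = H (y ∷ e) c
  grow-cons : ∀ b c → grow H' b c ≡ grow H (y ∷ b) c
  grow-cons b [] = refl
  grow-cons b (c₁ ∷ c) = refl

L-Σsplit : (F : List I → List I′ → List I′ → ℚ) (h : List (ℚ × List I)) (w : List I′) →
  L (λ ks → Σsplit (F ks) w) h ≡ Σsplit (λ a b → L (λ ks → F ks a b) h) w
L-Σsplit F h w = L-Σ (λ ks s → F ks (proj₁ s) (proj₂ s)) h (splits w)

Σsplit3-nested : (F : List I × List I × List I → ℚ) (w : List I) →
  Σsplit3 F w ≡ Σsplit (λ a r → Σsplit (λ b c → F (a , b , c)) r) w
Σsplit3-nested F w = trans (Σ-concatMap F _ (splits w)) (Σ-cong (splits w) (λ s → Σ-map F _ (splits (proj₂ s))))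

Σsplit3-cons : (F : List I × List I × List I → ℚ) (x : I) (xs : List I) →
  Σsplit3 F (x ∷ xs) ≡ Σsplit (λ b c → F ([] , b , c)) (x ∷ xs) + Σsplit3 (λ t → F (x ∷ proj₁ t , proj₂ t)) xs
Σsplit3-cons F x xs = trans (Σsplit3-nested F (x ∷ xs)) (trans (Σsplit-cons (λ a r → Σsplit (λ b c → F (a , b , c)) r) x xs)
  (cong (Σsplit (λ b c → F ([] , b , c)) (x ∷ xs) +_) (sym (Σsplit3-nested (λ t → F (x ∷ proj₁ t , proj₂ t)) xs))))

Σsplit3-cong : {F G : List I × List I × List I → ℚ} (w : List I) → (∀ t → F t ≡ G t) → Σsplit3 F w ≡ Σsplit3 G w
Σsplit3-cong w e = Σ-cong (splits3 w) e

Σsplit3-0 : {F : List I × List I × List I → ℚ} (w : List I) → (∀ t → F t ≡ 0ℚ) → Σsplit3 F w ≡ 0ℚ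
Σsplit3-0 w e = Σ-0 (splits3 w) e

Σsplit3-+ : (F G : List I × List I × List I → ℚ) (w : List I) → Σsplit3 (λ t → F t + G t) w ≡ Σsplit3 F w + Σsplit3 G w
Σsplit3-+ F G w = Σ-+ F G (splits3 w)

Σsplit3-* : (c : ℚ) (F : List I × List I × List I → ℚ) (w : List I) → Σsplit3 (λ t → c * F t) w ≡ c * Σsplit3 F w
Σsplit3-* c F w = Σ-* c F (splits3 w)

mu-cong : {A A' B B' : Mould} (w : List ℚ) → (∀ v → A v ≡ A' v) → (∀ v → B v ≡ B' v) → mu A B w ≡ mu A' B' w
mu-cong w e e' = Σsplit-cong w (λ a b → cong₂ _*_ (e a) (e' b))

mu-1ˡ : (B : Mould) (w : List ℚ) → mu (smon []) B w ≡ B w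
mu-1ˡ B [] = trans (+-identityʳ _) (*-identityˡ _)
mu-1ˡ B (y ∷ ys) = begin
    mu (smon []) B (y ∷ ys)
  ≡⟨ Σsplit-cons (λ a b → smon [] a * B b) y ys ⟩
    1ℚ * B (y ∷ ys) + Σsplit (λ a b → smon [] (y ∷ a) * B b) ys
  ≡⟨ cong (1ℚ * B (y ∷ ys) +_) (Σsplit-0 ys (λ a b → *-zeroˡ (B b))) ⟩
    1ℚ * B (y ∷ ys) + 0ℚ
  ≡⟨ trans (+-identityʳ _) (*-identityˡ _) ⟩
    B (y ∷ ys) ∎

mu-smon₁ : (k : ℕ) (B : Mould) (x : ℚ) (xs : List ℚ) → mu (smon (k ∷ [])) B (x ∷ xs) ≡ powℚ (- x) k * B xs
mu-smon₁ k B x xs = begin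
    mu (smon (k ∷ [])) B (x ∷ xs)
  ≡⟨ Σsplit-cons (λ a b → smon (k ∷ []) a * B b) x xs ⟩
    0ℚ * B (x ∷ xs) + Σsplit (λ a b → p * smon [] a * B b) xs
  ≡⟨ cong₂ _+_ (*-zeroˡ (B (x ∷ xs)))
       (trans (Σsplit-cong xs (λ a b → *-assoc p (smon [] a) (B b))) (Σsplit-* p (λ a b → smon [] a * B b) xs)) ⟩
    0ℚ + p * mu (smon []) B xs
  ≡⟨ trans (+-identityˡ _) (cong (p *_) (mu-1ˡ B xs)) ⟩
    p * B xs ∎
  where p = powℚ (- x) k

C₁m : Mould
C₁m = smon (0 ∷ [])

mu-C₁ˡ : (B : Mould) (x : ℚ) (xs : List ℚ) → mu C₁m B (x ∷ xs) ≡ B xs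
mu-C₁ˡ B x xs = trans (mu-smon₁ 0 B x xs) (*-identityˡ (B xs))

smon[]-snoc : (v : List ℚ) (y : ℚ) → smon [] (v ++ y ∷ []) ≡ 0ℚ
smon[]-snoc [] y = refl
smon[]-snoc (z ∷ v) y = refl

mu-C₁ʳ : (B : Mould) (v : List ℚ) (y : ℚ) → mu B C₁m (v ++ y ∷ []) ≡ B v
mu-C₁ʳ B [] y = solve 2 (λ b b' → b :* (con 1ℚ :* con 1ℚ) :+ (b' :* con 0ℚ :+ con 0ℚ) := b) refl (B []) (B (y ∷ []))
mu-C₁ʳ B (z ∷ v) y = begin
    mu B C₁m (z ∷ (v ++ y ∷ []))
  ≡⟨ Σsplit-cons (λ a b → B a * C₁m b) z (v ++ y ∷ []) ⟩
    B [] * (1ℚ * smon [] (v ++ y ∷ [])) + mu (λ a → B (z ∷ a)) C₁m (v ++ y ∷ [])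
  ≡⟨ cong₂ (λ s t → B [] * (1ℚ * s) + t) (smon[]-snoc v y) (mu-C₁ʳ (λ a → B (z ∷ a)) v y) ⟩
    B [] * (1ℚ * 0ℚ) + B (z ∷ v)
  ≡⟨ solve 2 (λ b c → b :* (con 1ℚ :* con 0ℚ) :+ c := c) refl (B []) (B (z ∷ v)) ⟩
    B (z ∷ v) ∎

smon-++ : (ks ls : List ℕ) (u : List ℚ) → smon (ks ++ ls) u ≡ mu (smon ks) (smon ls) u
smon-++ [] ls u = sym (mu-1ˡ (smon ls) u)
smon-++ (k ∷ ks) ls [] = sym (trans (+-identityʳ (smon (k ∷ ks) [] * smon ls [])) (*-zeroˡ (smon ls [])))
smon-++ (k ∷ ks) ls (x ∷ xs) = begin
    p * smon (ks ++ ls) xs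
  ≡⟨ cong (p *_) (smon-++ ks ls xs) ⟩
    p * Σsplit (λ a b → smon ks a * smon ls b) xs
  ≡⟨ sym (Σsplit-* p (λ a b → smon ks a * smon ls b) xs) ⟩
    Σsplit (λ a b → p * (smon ks a * smon ls b)) xs
  ≡⟨ Σsplit-cong xs (λ a b → sym (*-assoc p (smon ks a) (smon ls b))) ⟩
    Σsplit (λ a b → smon (k ∷ ks) (x ∷ a) * smon ls b) xs
  ≡⟨ sym (trans (cong (_+ rest) (*-zeroˡ (smon ls (x ∷ xs)))) (+-identityˡ rest)) ⟩
    smon (k ∷ ks) [] * smon ls (x ∷ xs) + Σsplit (λ a b → smon (k ∷ ks) (x ∷ a) * smon ls b) xs
  ≡⟨ sym (Σsplit-cons (λ a b → smon (k ∷ ks) a * smon ls b) x xs) ⟩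
    mu (smon (k ∷ ks)) (smon ls) (x ∷ xs) ∎
  where
  p = powℚ (- x) k
  rest = Σsplit (λ a b → smon (k ∷ ks) (x ∷ a) * smon ls b) xs

mould-++ : (f g : CPoly) (u : List ℚ) → mould (f ++ g) u ≡ mould f u + mould g u
mould-++ f g u = L-++ _ f g

mould-neg : (f : CPoly) (u : List ℚ) → mould (cneg f) u ≡ - mould f u
mould-neg f u = L-cneg (λ ks → smon ks u) f

mould-cmon : (ks : List ℕ) (u : List ℚ) → mould (cmon ks) u ≡ smon ks u
mould-cmon ks u = L-cmon (λ ks → smon ks u) ks

mould-cmul : (f g : CPoly) (u : List ℚ) → mould (cmul f g) u ≡ mu (mould f) (mould g) u
mould-cmul f g u = begin
    L (λ ks → smon ks u) (cmul f g)
  ≡⟨ L-cmul _ f g ⟩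
    L (λ ks → L (λ ls → smon (ks ++ ls) u) g) f
  ≡⟨ L-cong f (λ ks → L-cong g (λ ls → smon-++ ks ls u)) ⟩
    L (λ ks → L (λ ls → Σsplit (λ a b → smon ks a * smon ls b) u) g) f
  ≡⟨ L-cong f (λ ks → L-Σsplit (λ ls a b → smon ks a * smon ls b) g u) ⟩
    L (λ ks → Σsplit (λ a b → L (λ ls → smon ks a * smon ls b) g) u) f
  ≡⟨ L-Σsplit (λ ks a b → L (λ ls → smon ks a * smon ls b) g) f u ⟩
    Σsplit (λ a b → L (λ ks → L (λ ls → smon ks a * smon ls b) g) f) u
  ≡⟨ Σsplit-cong u (λ a b → trans (L-cong f (λ ks → L-* (smon ks a) (λ ls → smon ls b) g)) (L-*ʳ _ (λ ks → smon ks a) f)) ⟩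
    mu (mould f) (mould g) u ∎

raise-smon : (ks : List ℕ) (u : List ℚ) → Σℚ (map (λ ks' → smon ks' u) (raise ks)) ≡ (- Σℚ u) * smon ks u
raise-smon [] [] = solve 0 (con 0ℚ := :- con 0ℚ :* con 1ℚ) refl
raise-smon [] (x ∷ u) = sym (*-zeroʳ (- (x + Σℚ u)))
raise-smon (k ∷ ks) [] = trans (cong (0ℚ +_) (trans (Σ-map (λ ks' → smon ks' []) (k ∷_) (raise ks)) (Σ-0 (raise ks) (λ _ → refl))))
  (solve 0 (con 0ℚ :+ con 0ℚ := :- con 0ℚ :* con 0ℚ) refl)
raise-smon (k ∷ ks) (x ∷ xs) = begin
    (- x) * P * S + Σℚ (map (λ ks' → smon ks' (x ∷ xs)) (map (k ∷_) (raise ks)))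
  ≡⟨ cong ((- x) * P * S +_) (trans (Σ-map (λ ks' → smon ks' (x ∷ xs)) (k ∷_) (raise ks))
        (trans (Σ-* P (λ ks' → smon ks' xs) (raise ks)) (cong (P *_) (raise-smon ks xs)))) ⟩
    (- x) * P * S + P * ((- Σℚ xs) * S)
  ≡⟨ solve 4 (λ x P S t → (:- x) :* P :* S :+ P :* ((:- t) :* S) := (:- (x :+ t)) :* (P :* S)) refl x P S (Σℚ xs) ⟩
    (- (x + Σℚ xs)) * (P * S) ∎
  where
  P = powℚ (- x) k
  S = smon ks xs

mould-adC : (h : CPoly) (u : List ℚ) → mould (adC h) u ≡ (- Σℚ u) * mould h u
mould-adC h u = trans (L-adC _ h) (trans (L-cong h (λ ks → raise-smon ks u)) (L-* (- Σℚ u) (λ ks → smon ks u) h))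

mould-adC^ : (k : ℕ) (h : CPoly) (u : List ℚ) → mould (adC^ k h) u ≡ powℚ (- Σℚ u) k * mould h u
mould-adC^ zero h u = sym (*-identityˡ _)
mould-adC^ (suc k) h u = begin
    mould (adC (adC^ k h)) u                     ≡⟨ mould-adC (adC^ k h) u ⟩
    s * mould (adC^ k h) u                       ≡⟨ cong (s *_) (mould-adC^ k h u) ⟩
    s * (powℚ s k * mould h u)                   ≡⟨ sym (*-assoc s (powℚ s k) (mould h u)) ⟩
    powℚ s (suc k) * mould h u ∎
  where s = - Σℚ u

-- We compare
-- arit(A)(smon (k ∷ ks)) at (x ∷ xs) with arit(A)(smon ks) at xs: the terms
-- whose first block starts with x differ by the factor (-x)^k, except the
-- "head" terms with first block [] (left) or exactly [x] (right).

module AritMonomial (A : Mould) where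

  arit-unit : (w : List ℚ) → arit A (smon []) w ≡ 0ℚ
  arit-unit w = trans (cong₂ (λ a b → a + - b) (Σsplit3-0 w left-unit) (Σsplit3-0 w right-unit))
                      (solve 0 (con 0ℚ :+ :- con 0ℚ := con 0ℚ) refl)
    where
    left-unit : (t : List ℚ × List ℚ × List ℚ) → leftTerm (smon []) A t ≡ 0ℚ
    left-unit (a , [] , c) = refl
    left-unit (a , (b ∷ bs) , []) = refl
    left-unit ([] , (b ∷ bs) , c₁ ∷ c) = *-zeroˡ (A (b ∷ bs))
    left-unit ((y ∷ a) , (b ∷ bs) , c₁ ∷ c) = *-zeroˡ (A (b ∷ bs))
    right-unit : (t : List ℚ × List ℚ × List ℚ) → rightTerm (smon []) A t ≡ 0ℚ
    right-unit ([] , b , c) = refl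
    right-unit ((x ∷ a) , [] , c) = refl
    right-unit ((x ∷ []) , (b ∷ bs) , c) = *-zeroˡ (A (b ∷ bs))
    right-unit ((x ∷ y ∷ a) , (b ∷ bs) , c) = *-zeroˡ (A (b ∷ bs))

  module _ (k : ℕ) (ks : List ℕ) where
    leftTerm-cons : (x : ℚ) (t : List ℚ × List ℚ × List ℚ) →
      leftTerm (smon (k ∷ ks)) A (x ∷ proj₁ t , proj₂ t) ≡ powℚ (- x) k * leftTerm (smon ks) A t
    leftTerm-cons x (a , [] , c) = sym (*-zeroʳ (powℚ (- x) k))
    leftTerm-cons x (a , (b ∷ bs) , []) = sym (*-zeroʳ (powℚ (- x) k))
    leftTerm-cons x (a , (b ∷ bs) , c₁ ∷ c) = *-assoc (powℚ (- x) k) (smon ks (a ++ (Σℚ (b ∷ bs) + c₁) ∷ c)) (A (b ∷ bs))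

    rightFirst : ℚ → List ℚ → List ℚ → List ℚ → ℚ
    rightFirst x [] b c = rightTerm (smon (k ∷ ks)) A (x ∷ [] , b , c)
    rightFirst x (_ ∷ _) b c = 0ℚ

    rightTerm-cons : (x : ℚ) (t : List ℚ × List ℚ × List ℚ) →
      rightTerm (smon (k ∷ ks)) A (x ∷ proj₁ t , proj₂ t)
        ≡ powℚ (- x) k * rightTerm (smon ks) A t + rightFirst x (proj₁ t) (proj₁ (proj₂ t)) (proj₂ (proj₂ t))
    rightTerm-cons x ([] , b , c) =
      sym (trans (cong (_+ rightFirst x [] b c) (*-zeroʳ (powℚ (- x) k))) (+-identityˡ (rightFirst x [] b c)))
    rightTerm-cons x ((y ∷ a) , [] , c) = solve 1 (λ p → con 0ℚ := p :* con 0ℚ :+ con 0ℚ) refl (powℚ (- x) k)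
    rightTerm-cons x ((y ∷ a) , (b ∷ bs) , c) =
      trans (*-assoc (powℚ (- x) k) (smon ks (capR (y ∷ a) (Σℚ (b ∷ bs)) c)) (A (b ∷ bs))) (sym (+-identityʳ _))

    leftHead rightHead : ℚ → List ℚ → ℚ
    leftHead x xs = Σsplit (λ b c → leftTerm (smon (k ∷ ks)) A ([] , b , c)) (x ∷ xs)
    rightHead x xs = Σsplit (λ b c → rightTerm (smon (k ∷ ks)) A (x ∷ [] , b , c)) xs

    arit-nil : arit A (smon (k ∷ ks)) [] ≡ 0ℚ
    arit-nil = solve 0 (con 0ℚ :+ con 0ℚ :+ :- (con 0ℚ :+ con 0ℚ) := con 0ℚ) refl

    arit-cons : (x : ℚ) (xs : List ℚ) →
      arit A (smon (k ∷ ks)) (x ∷ xs) ≡ powℚ (- x) k * arit A (smon ks) xs + (leftHead x xs + - rightHead x xs)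
    arit-cons x xs = begin
        Σsplit3 (leftTerm (smon (k ∷ ks)) A) (x ∷ xs) + - Σsplit3 (rightTerm (smon (k ∷ ks)) A) (x ∷ xs)
      ≡⟨ cong₂ (λ a b → a + - b) (Σsplit3-cons (leftTerm (smon (k ∷ ks)) A) x xs)
                                  (Σsplit3-cons (rightTerm (smon (k ∷ ks)) A) x xs) ⟩
        (leftHead x xs + Σsplit3 (λ t → leftTerm (smon (k ∷ ks)) A (x ∷ proj₁ t , proj₂ t)) xs)
          + - (rightEmpty + Σsplit3 (λ t → rightTerm (smon (k ∷ ks)) A (x ∷ proj₁ t , proj₂ t)) xs)
      ≡⟨ cong₂ (λ a b → (leftHead x xs + a) + - (rightEmpty + b))
           (trans (Σsplit3-cong xs (leftTerm-cons x)) (Σsplit3-* p (leftTerm (smon ks) A) xs))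
           (trans (Σsplit3-cong xs (rightTerm-cons x))
             (trans (Σsplit3-+ (λ t → p * rightTerm (smon ks) A t) first xs)
                    (cong₂ _+_ (Σsplit3-* p (rightTerm (smon ks) A) xs) rightFirst-sum))) ⟩
        (leftHead x xs + p * TL) + - (rightEmpty + (p * TR + rightHead x xs))
      ≡⟨ cong (λ a → (leftHead x xs + p * TL) + - (a + (p * TR + rightHead x xs))) (Σsplit-0 (x ∷ xs) (λ b c → refl)) ⟩
        (leftHead x xs + p * TL) + - (0ℚ + (p * TR + rightHead x xs))
      ≡⟨ solve 5 (λ L p a b R → (L :+ p :* a) :+ :- (con 0ℚ :+ (p :* b :+ R)) := p :* (a :+ :- b) :+ (L :+ :- R))
           refl (leftHead x xs) p TL TR (rightHead x xs) ⟩
        p * arit A (smon ks) xs + (leftHead x xs + - rightHead x xs) ∎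
      where
      p = powℚ (- x) k
      TL = Σsplit3 (leftTerm (smon ks) A) xs
      TR = Σsplit3 (rightTerm (smon ks) A) xs
      rightEmpty = Σsplit (λ b c → rightTerm (smon (k ∷ ks)) A ([] , b , c)) (x ∷ xs)
      first : List ℚ × List ℚ × List ℚ → ℚ
      first t = rightFirst x (proj₁ t) (proj₁ (proj₂ t)) (proj₂ (proj₂ t))
      rightFirst-sum : Σsplit3 first xs ≡ rightHead x xs
      rightFirst-sum = begin
          Σsplit3 first xs
        ≡⟨ Σsplit3-nested first xs ⟩
          Σsplit (λ a r → Σsplit (λ b c → rightFirst x a b c) r) xs
        ≡⟨ Σsplit-head (λ a r → Σsplit (λ b c → rightFirst x a b c) r) xs ⟩
          rightHead x xs + Σsplit⁺ (λ a r → Σsplit (λ b c → rightFirst x a b c) r) xs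
        ≡⟨ cong (rightHead x xs +_) (Σsplit⁺-0 xs (λ y a r → Σsplit-0 r (λ b c → refl))) ⟩
          rightHead x xs + 0ℚ
        ≡⟨ +-identityʳ (rightHead x xs) ⟩
          rightHead x xs ∎

  -- the mould of ad(x)^k [C₁, F] when A is the mould of F
  adBr : ℕ → Mould
  adBr k v = powℚ (- Σℚ v) k * (mu C₁m A v + - mu A C₁m v)

  module _ (k : ℕ) (ks : List ℕ) where
    adBr-nil : adBr k [] ≡ 0ℚ
    adBr-nil = solve 2 (λ p a → p :* ((con 0ℚ :* a :+ con 0ℚ) :+ :- (a :* con 0ℚ :+ con 0ℚ)) := con 0ℚ) refl (powℚ (- 0ℚ) k) (A [])

    -- In adBr k (x ∷ e) = (-(x + Σe))^k (A e - mu A C₁m (x ∷ e)) the two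
    -- summands, multiplied by smon ks c, give the following contributions.
    weight : ℚ → List ℚ → ℚ
    weight x e = powℚ (- (x + Σℚ e)) k

    fromC₁A fromAC₁ : ℚ → List ℚ → List ℚ → ℚ
    fromC₁A x e c = weight x e * A e * smon ks c
    fromAC₁ x e c = weight x e * mu A C₁m (x ∷ e) * smon ks c

    -- C₁·A yields the right head terms (plus the term with e = [])
    fromC₁A-sum : (x : ℚ) (xs : List ℚ) → Σsplit (fromC₁A x) xs ≡ fromC₁A x [] xs + rightHead k ks x xs
    fromC₁A-sum x xs = begin
        Σsplit (fromC₁A x) xs
      ≡⟨ Σsplit-head (fromC₁A x) xs ⟩
        fromC₁A x [] xs + Σsplit⁺ (fromC₁A x) xs
      ≡⟨ cong (fromC₁A x [] xs +_) (Σsplit⁺-cong xs (λ y b c →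
           solve 3 (λ p a s → p :* a :* s := p :* s :* a) refl (weight x (y ∷ b)) (A (y ∷ b)) (smon ks c))) ⟩
        fromC₁A x [] xs + Σsplit⁺ (λ b c → rightTerm (smon (k ∷ ks)) A (x ∷ [] , b , c)) xs
      ≡⟨ cong (fromC₁A x [] xs +_)
           (sym (trans (Σsplit-head (λ b c → rightTerm (smon (k ∷ ks)) A (x ∷ [] , b , c)) xs) (+-identityˡ _))) ⟩
        fromC₁A x [] xs + rightHead k ks x xs ∎

    -- A·C₁ yields the left head terms: the last letter of x ∷ e is absorbed by C₁
    fromAC₁-grow : (x : ℚ) → ∀ b c → grow (fromAC₁ x) b c ≡ leftTerm (smon (k ∷ ks)) A ([] , x ∷ b , c)
    fromAC₁-grow x b [] = refl
    fromAC₁-grow x b (c₁ ∷ c) = begin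
        weight x (b ++ c₁ ∷ []) * mu A C₁m (x ∷ (b ++ c₁ ∷ [])) * smon ks c
      ≡⟨ cong₂ (λ s t → s * t * smon ks c)
           (cong (λ t → powℚ t k) (trans (cong (λ t → - (x + t)) (Σ-++ b (c₁ ∷ [])))
              (solve 3 (λ x s c → :- (x :+ (s :+ (c :+ con 0ℚ))) := :- ((x :+ s) :+ c)) refl x (Σℚ b) c₁)))
           (mu-C₁ʳ A (x ∷ b) c₁) ⟩
        powℚ (- ((x + Σℚ b) + c₁)) k * A (x ∷ b) * smon ks c
      ≡⟨ solve 3 (λ p a s → p :* a :* s := p :* s :* a) refl (powℚ (- ((x + Σℚ b) + c₁)) k) (A (x ∷ b)) (smon ks c) ⟩
        leftTerm (smon (k ∷ ks)) A ([] , x ∷ b , c₁ ∷ c) ∎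

    fromAC₁-sum : (x : ℚ) (xs : List ℚ) → Σsplit (fromAC₁ x) xs ≡ fromC₁A x [] xs + leftHead k ks x xs
    fromAC₁-sum x xs = begin
        Σsplit (fromAC₁ x) xs
      ≡⟨ Σsplit-grow (fromAC₁ x) xs ⟩
        fromAC₁ x [] xs + Σsplit (grow (fromAC₁ x)) xs
      ≡⟨ cong₂ _+_ (cong (λ t → weight x [] * t * smon ks xs) (mu-C₁ʳ A [] x)) (Σsplit-cong xs (fromAC₁-grow x)) ⟩
        fromC₁A x [] xs + Σsplit (λ b c → leftTerm (smon (k ∷ ks)) A ([] , x ∷ b , c)) xs
      ≡⟨ cong (fromC₁A x [] xs +_) (sym (trans (Σsplit-cons (λ b c → leftTerm (smon (k ∷ ks)) A ([] , b , c)) x xs) (+-identityˡ _))) ⟩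
        fromC₁A x [] xs + leftHead k ks x xs ∎

    mu-adBr : (x : ℚ) (xs : List ℚ) → mu (adBr k) (smon ks) (x ∷ xs) ≡ rightHead k ks x xs + - leftHead k ks x xs
    mu-adBr x xs = begin
        mu (adBr k) (smon ks) (x ∷ xs)
      ≡⟨ Σsplit-cons (λ a b → adBr k a * smon ks b) x xs ⟩
        adBr k [] * smon ks (x ∷ xs) + Σsplit (λ e c → adBr k (x ∷ e) * smon ks c) xs
      ≡⟨ cong₂ _+_ (trans (cong (_* smon ks (x ∷ xs)) adBr-nil) (*-zeroˡ (smon ks (x ∷ xs)))) (Σsplit-cong xs expand) ⟩
        0ℚ + Σsplit (λ e c → fromC₁A x e c + - fromAC₁ x e c) xs
      ≡⟨ trans (+-identityˡ _) (trans (Σsplit-+ (fromC₁A x) (λ e c → - fromAC₁ x e c) xs)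
                                      (cong (Σsplit (fromC₁A x) xs +_) (Σsplit-neg (fromAC₁ x) xs))) ⟩
        Σsplit (fromC₁A x) xs + - Σsplit (fromAC₁ x) xs
      ≡⟨ cong₂ (λ a b → a + - b) (fromC₁A-sum x xs) (fromAC₁-sum x xs) ⟩
        (Z + rightHead k ks x xs) + - (Z + leftHead k ks x xs)
      ≡⟨ solve 3 (λ z r l → (z :+ r) :+ :- (z :+ l) := r :+ :- l) refl Z (rightHead k ks x xs) (leftHead k ks x xs) ⟩
        rightHead k ks x xs + - leftHead k ks x xs ∎
      where
      Z = fromC₁A x [] xs
      expand : ∀ e c → adBr k (x ∷ e) * smon ks c ≡ fromC₁A x e c + - fromAC₁ x e c
      expand e c = trans (cong (λ t → weight x e * (t + - mu A C₁m (x ∷ e)) * smon ks c) (mu-C₁ˡ A x e))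
        (solve 4 (λ p a m s → p :* (a :+ :- m) :* s := p :* a :* s :+ :- (p :* m :* s))
           refl (weight x e) (A e) (mu A C₁m (x ∷ e)) (smon ks c))

    -- the Leibniz step: D(C_{k+1} M) = D(C_{k+1}) M + C_{k+1} D(M) on moulds
    leibniz-step : (w : List ℚ) →
      mu (adBr k) (smon ks) w + mu (smon (k ∷ [])) (λ v → - arit A (smon ks) v) w ≡ - arit A (smon (k ∷ ks)) w
    leibniz-step [] = trans (cong (λ e → (e * smon ks [] + 0ℚ) + (0ℚ * (- arit A (smon ks) []) + 0ℚ)) adBr-nil)
        (trans (solve 2 (λ s t → (con 0ℚ :* s :+ con 0ℚ) :+ (con 0ℚ :* t :+ con 0ℚ) := :- con 0ℚ) refl (smon ks []) (- arit A (smon ks) []))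
          (cong -_ (sym (arit-nil k ks))))
    leibniz-step (x ∷ xs) = begin
        mu (adBr k) (smon ks) (x ∷ xs) + mu (smon (k ∷ [])) (λ v → - arit A (smon ks) v) (x ∷ xs)
      ≡⟨ cong₂ _+_ (mu-adBr x xs) (mu-smon₁ k (λ v → - arit A (smon ks) v) x xs) ⟩
        (rightHead k ks x xs + - leftHead k ks x xs) + powℚ (- x) k * (- arit A (smon ks) xs)
      ≡⟨ solve 4 (λ r l p a → (r :+ :- l) :+ p :* (:- a) := :- (p :* a :+ (l :+ :- r))) refl
           (rightHead k ks x xs) (leftHead k ks x xs) (powℚ (- x) k) (arit A (smon ks) xs) ⟩
        - (powℚ (- x) k * arit A (smon ks) xs + (leftHead k ks x xs + - rightHead k ks x xs))
      ≡⟨ cong -_ (sym (arit-cons k ks x xs)) ⟩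
        - arit A (smon (k ∷ ks)) (x ∷ xs) ∎

  arit-linear : (G : CPoly) (w : List ℚ) → arit A (mould G) w ≡ L (λ ks → arit A (smon ks) w) G
  arit-linear G w = begin
      Σsplit3 (leftTerm (mould G) A) w + - Σsplit3 (rightTerm (mould G) A) w
    ≡⟨ cong₂ (λ a b → a + - b) (trans (Σsplit3-cong w left-linear) (sym (L-Σ (λ ks → leftTerm (smon ks) A) G (splits3 w))))
                                (trans (Σsplit3-cong w right-linear) (sym (L-Σ (λ ks → rightTerm (smon ks) A) G (splits3 w)))) ⟩
      L (λ ks → Σsplit3 (leftTerm (smon ks) A) w) G + - L (λ ks → Σsplit3 (rightTerm (smon ks) A) w) G
    ≡⟨ cong (L (λ ks → Σsplit3 (leftTerm (smon ks) A) w) G +_) (sym (L-neg (λ ks → Σsplit3 (rightTerm (smon ks) A) w) G)) ⟩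
      L (λ ks → Σsplit3 (leftTerm (smon ks) A) w) G + L (λ ks → - Σsplit3 (rightTerm (smon ks) A) w) G
    ≡⟨ sym (L-+ (λ ks → Σsplit3 (leftTerm (smon ks) A) w) (λ ks → - Σsplit3 (rightTerm (smon ks) A) w) G) ⟩
      L (λ ks → arit A (smon ks) w) G ∎
    where
    left-linear : (t : List ℚ × List ℚ × List ℚ) → leftTerm (mould G) A t ≡ L (λ ks → leftTerm (smon ks) A t) G
    left-linear (a , [] , c) = sym (L-0 G)
    left-linear (a , (b ∷ bs) , []) = sym (L-0 G)
    left-linear (a , (b ∷ bs) , c₁ ∷ c) = sym (L-*ʳ (A (b ∷ bs)) (λ ks → smon ks (a ++ (Σℚ (b ∷ bs) + c₁) ∷ c)) G)
    right-linear : (t : List ℚ × List ℚ × List ℚ) → rightTerm (mould G) A t ≡ L (λ ks → rightTerm (smon ks) A t) G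
    right-linear ([] , b , c) = sym (L-0 G)
    right-linear ((x ∷ a) , [] , c) = sym (L-0 G)
    right-linear ((x ∷ a) , (b ∷ bs) , c) = sym (L-*ʳ (A (b ∷ bs)) (λ ks → smon ks (capR (x ∷ a) (Σℚ (b ∷ bs)) c)) G)

module _ (F : CPoly) where
  private A = mould F
  open AritMonomial A

  mould-brC₁ : (v : List ℚ) → mould (brC₁ F) v ≡ mu C₁m A v + - mu A C₁m v
  mould-brC₁ v = trans (mould-++ (cmul C₁ F) (cneg (cmul F C₁)) v)
    (cong₂ _+_ (trans (mould-cmul C₁ F v) (mu-cong {B = A} v (mould-cmon (0 ∷ [])) (λ _ → refl)))
               (trans (mould-neg (cmul F C₁) v) (cong -_ (trans (mould-cmul F C₁ v) (mu-cong {A = A} v (λ _ → refl) (mould-cmon (0 ∷ [])))))))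
    where C₁ = cmon (0 ∷ [])

  mould-D-Cidx : (k : ℕ) (v : List ℚ) → mould (adC^ k (brC₁ F)) v ≡ adBr k v
  mould-D-Cidx k v = trans (mould-adC^ k (brC₁ F) v) (cong (powℚ (- Σℚ v) k *_) (mould-brC₁ v))

  mould-cD-mon : (ks : List ℕ) (w : List ℚ) → mould (cD-mon F ks) w ≡ - arit A (smon ks) w
  mould-cD-mon [] w = sym (trans (cong -_ (arit-unit w)) (solve 0 (:- con 0ℚ := con 0ℚ) refl))
  mould-cD-mon (k ∷ ks) w = begin
      mould (cmul (adC^ k (brC₁ F)) (cmon ks) ++ cmul (cmon (k ∷ [])) (cD-mon F ks)) w
    ≡⟨ mould-++ (cmul (adC^ k (brC₁ F)) (cmon ks)) (cmul (cmon (k ∷ [])) (cD-mon F ks)) w ⟩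
      mould (cmul (adC^ k (brC₁ F)) (cmon ks)) w + mould (cmul (cmon (k ∷ [])) (cD-mon F ks)) w
    ≡⟨ cong₂ _+_ (trans (mould-cmul (adC^ k (brC₁ F)) (cmon ks) w) (mu-cong w (mould-D-Cidx k) (mould-cmon ks)))
                 (trans (mould-cmul (cmon (k ∷ [])) (cD-mon F ks) w) (mu-cong w (mould-cmon (k ∷ [])) (mould-cD-mon ks))) ⟩
      mu (adBr k) (smon ks) w + mu (smon (k ∷ [])) (λ v → - arit A (smon ks) v) w
    ≡⟨ leibniz-step k ks w ⟩
      - arit A (smon (k ∷ ks)) w ∎

  mould-cD : (G : CPoly) (w : List ℚ) → mould (cD F G) w ≡ - arit A (mould G) w
  mould-cD G w = begin
      mould (cD F G) w                     ≡⟨ L-cD (λ ks → smon ks w) F G ⟩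
      L (λ ks → mould (cD-mon F ks) w) G   ≡⟨ L-cong G (λ ks → mould-cD-mon ks w) ⟩
      L (λ ks → - arit A (smon ks) w) G    ≡⟨ L-neg (λ ks → arit A (smon ks) w) G ⟩
      - L (λ ks → arit A (smon ks) w) G    ≡⟨ cong -_ (sym (arit-linear G w)) ⟩
      - arit A (mould G) w ∎

mould-cpoisson : (f g : CPoly) (w : List ℚ) → mould (cpoisson f g) w ≡ ari (mould f) (mould g) w
mould-cpoisson f g w = begin
    mould (cpoisson f g) w
  ≡⟨ trans (mould-++ (cmul f g) _ w) (cong (mould (cmul f g) w +_)
       (trans (mould-++ (cneg (cmul g f)) _ w) (cong (mould (cneg (cmul g f)) w +_) (mould-++ (cD f g) _ w)))) ⟩
    mould (cmul f g) w + (mould (cneg (cmul g f)) w + (mould (cD f g) w + mould (cneg (cD g f)) w))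
  ≡⟨ cong₂ _+_ (mould-cmul f g w)
       (cong₂ _+_ (trans (mould-neg (cmul g f) w) (cong -_ (mould-cmul g f w)))
         (cong₂ _+_ (mould-cD f g w) (trans (mould-neg (cD g f) w) (cong -_ (mould-cD g f w))))) ⟩
    mu Af Ag w + (- mu Ag Af w + (- arit Af Ag w + - (- arit Ag Af w)))
  ≡⟨ solve 4 (λ a b c d → a :+ (:- b :+ (:- c :+ :- (:- d))) := d :+ :- c :+ (a :+ :- b)) refl
       (mu Af Ag w) (mu Ag Af w) (arit Af Ag w) (arit Ag Af w) ⟩
    ari Af Ag w ∎
  where
  Af = mould f
  Ag = mould g

ari-cong : {A A' B B' : Mould} → (∀ v → A v ≡ A' v) → (∀ v → B v ≡ B' v) → (w : List ℚ) → ari A B w ≡ ari A' B' w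
ari-cong {A} {A'} {B} {B'} eA eB w =
  cong₂ _+_ (cong₂ (λ a b → a + - b) (arit-cong eB eA) (arit-cong eA eB))
            (cong₂ (λ a b → a + - b) (mu-cong w eA eB) (mu-cong w eB eA))
  where
  arit-cong : {C C' D D' : Mould} → (∀ v → D v ≡ D' v) → (∀ v → C v ≡ C' v) → arit D C w ≡ arit D' C' w
  arit-cong {C} {C'} {D} {D'} eD eC = cong₂ (λ a b → a + - b) (Σsplit3-cong w left) (Σsplit3-cong w right)
    where
    left : (t : List ℚ × List ℚ × List ℚ) → leftTerm C D t ≡ leftTerm C' D' t
    left (a , [] , c) = refl
    left (a , (b ∷ bs) , []) = refl
    left (a , (b ∷ bs) , c₁ ∷ c) = cong₂ _*_ (eC _) (eD _)
    right : (t : List ℚ × List ℚ × List ℚ) → rightTerm C D t ≡ rightTerm C' D' t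
    right ([] , b , c) = refl
    right ((x ∷ a) , [] , c) = refl
    right ((x ∷ a) , (b ∷ bs) , c) = cong₂ _*_ (eC _) (eD _)

ma-cpoisson : (f g : CPoly) → ma (cpoisson f g) ≈M ari (ma f) (ma g)
ma-cpoisson f g u = begin
    ma (cpoisson f g) u            ≡⟨ ma≡mould (cpoisson f g) u ⟩
    mould (cpoisson f g) u         ≡⟨ mould-cpoisson f g u ⟩
    ari (mould f) (mould g) u      ≡⟨ sym (ari-cong (ma≡mould f) (ma≡mould g) u) ⟩
    ari (ma f) (ma g) u ∎

corollary3p3p4 : (n r m s : ℕ) (f g : CPoly) →
    Homogeneous n r (evalC f) → Homogeneous m s (evalC g) →
    Σ CPoly (λ h → evalC h ≈P poisson (evalC f) (evalC g))
    × ((h : CPoly) → evalC h ≈P poisson (evalC f) (evalC g) →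
        ma h ≈M ari (ma f) (ma g))
corollary3p3p4 _ _ _ _ f g _ _ = (cpoisson f g , ≅⇒≈P (evalC-cpoisson f g)) , bracket-mould
  where
  bracket-mould : (h : CPoly) → evalC h ≈P poisson (evalC f) (evalC g) → ma h ≈M ari (ma f) (ma g)
  bracket-mould h e u = begin
      ma h u
    ≡⟨ ma-respects-≅ h (cpoisson f g) (≅-trans (≈P⇒≅ e) (≅-sym (evalC-cpoisson f g))) u ⟩
      ma (cpoisson f g) u
    ≡⟨ ma-cpoisson f g u ⟩
      ari (ma f) (ma g) u ∎
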